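{- Let $M\in\mathbb{Z}^{r\times m}$ of rank $r$ with $d_r(M)=1$, and suppose $M$ is not plain. Then $M$ has an extension $M'\in\mathbb{Z}^{m\times(2m-r)}$ with index set $J=[m]$, such that $M'=U(I_m\,|\,B)$ where $U\in\mathbb{Z}^{m\times m}$ is unimodular and every row of $B$ is nonzero.
   Context: $d_r(M)$: gcd of nonzero $r\times r$ minors of $M$. $\ker_G M=\{x\in G^m:Mx=0\}$. $M$ is plain if there is $\ell\in[m]$ with $p_\ell(\ker_G M)=\{0_G\}$ for every abelian group $G$ ($p_\ell$ the $\ell$-th coordinate projection). For $J\subset[m']$, $|J|=m$, $\pi_J:G^{m'}\to G^m$ sends $(g_j)$ to $(g_{\sigma_J(j)})_{j\in[m]}$ with $\sigma_J:[m]\to J$ order-preserving. $M'\in\mathbb{Z}^{r'\times m'}$ ($r'\ge r,m'\ge m$) is an extension of $M$ with index set $J$ if for every abelian group $G$, $\pi_J$ restricts to an isomorphism $\ker_G M'\to\ker_G M$. $I_m$ is the identity matrix; unimodular means determinant $\pm1$. -}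

module Defs where

open import Level using (0ℓ)
open import Data.Nat as ℕ using (ℕ; zero; suc)
open import Data.Nat.Divisibility using (_∣_)
open import Data.Integer as ℤ using (ℤ; +_; -[1+_]; 0ℤ; 1ℤ; -1ℤ; ∣_∣)
open import Data.Fin as Fin using (Fin; zero; suc; punchIn; _<_)
open import Data.Fin.Base using (splitAt)
open import Data.Sum using (inj₁; inj₂)
open import Data.Product using (Σ; ∃; _×_; _,_)
open import Relation.Binary.PropositionalEquality using (_≡_; _≢_)
open import Relation.Nullary using (¬_)
open import Algebra.Bundles using (AbelianGroup)

Mat : ℕ → ℕ → Set
Mat r m = Fin r → Fin m → ℤ

sumℤ : ∀ n → (Fin n → ℤ) → ℤ
sumℤ zero    f = 0ℤ
sumℤ (suc n) f = f zero ℤ.+ sumℤ n (λ i → f (suc i))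

_⊗_ : ∀ {a b c} → Mat a b → Mat b c → Mat a c
_⊗_ {b = b} A B i k = sumℤ b (λ j → A i j ℤ.* B j k)

alt : ℕ → ℤ
alt zero    = 1ℤ
alt (suc n) = ℤ.- alt n

det : ∀ n → Mat n n → ℤ
det zero    A = 1ℤ
det (suc n) A =
  sumℤ (suc n) (λ j → alt (Fin.toℕ j) ℤ.* (A zero j ℤ.* det n (λ i k → A (suc i) (punchIn j k))))

Unimodular : ∀ {n} → Mat n n → Set
Unimodular {n} U = (det n U ≡ 1ℤ) Data.Sum.⊎ (det n U ≡ -1ℤ)
  where import Data.Sum

Iₘ : ∀ m → Mat m m
Iₘ m i j with i Fin.≟ j
... | Relation.Nullary.yes _ = 1ℤ
... | Relation.Nullary.no  _ = 0ℤ

_∣∣_ : ∀ {m a b} → Mat m a → Mat m b → Mat m (a ℕ.+ b)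
_∣∣_ {a = a} A B i j with splitAt a j
... | inj₁ j₁ = A i j₁
... | inj₂ j₂ = B i j₂

StrictlyIncreasing : ∀ {k n} → (Fin k → Fin n) → Set
StrictlyIncreasing σ = ∀ i j → i < j → σ i < σ j

minor : ∀ {r m} k → Mat r m → (Fin k → Fin r) → (Fin k → Fin m) → ℤ
minor k M ρ κ = det k (λ i j → M (ρ i) (κ j))

HasNonzeroMinor : ∀ {r m} → ℕ → Mat r m → Set
HasNonzeroMinor {r} {m} k M =
  Σ (Fin k → Fin r) λ ρ → Σ (Fin k → Fin m) λ κ →
    StrictlyIncreasing ρ × StrictlyIncreasing κ × minor k M ρ κ ≢ 0ℤ

HasRank : ∀ {r m} → Mat r m → ℕ → Set
HasRank M k = HasNonzeroMinor k M × ¬ HasNonzeroMinor (suc k) M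

DividesNonzeroMinors : ∀ {r m} → ℕ → Mat r m → ℕ → Set
DividesNonzeroMinors {r} {m} k M d =
  (ρ : Fin k → Fin r) (κ : Fin k → Fin m) →
    StrictlyIncreasing ρ → StrictlyIncreasing κ →
    minor k M ρ κ ≢ 0ℤ → d ∣ ∣ minor k M ρ κ ∣

IsDk : ∀ {r m} → ℕ → Mat r m → ℕ → Set
IsDk k M d =
  DividesNonzeroMinors k M d ×
  (∀ e → DividesNonzeroMinors k M e → e ∣ d)

module _ (G : AbelianGroup 0ℓ 0ℓ) where
  open AbelianGroup G renaming (Carrier to A)
  open import Algebra.Definitions.RawMonoid rawMonoid using ()
    renaming (_×_ to _·ℕ_)

  zmul : ℤ → A → A
  zmul (+ n)    g = n ·ℕ g
  zmul -[1+ n ] g = (suc n ·ℕ g) ⁻¹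

  sumG : ∀ n → (Fin n → A) → A
  sumG zero    f = ε
  sumG (suc n) f = f zero ∙ sumG n (λ i → f (suc i))

  InKer : ∀ {r m} → Mat r m → (Fin m → A) → Set
  InKer {r} {m} M x = ∀ i → sumG m (λ j → zmul (M i j) (x j)) ≈ ε

Plain : ∀ {r m} → Mat r m → Set₁
Plain {r} {m} M =
  Σ (Fin m) λ ℓ → (G : AbelianGroup 0ℓ 0ℓ) → (x : Fin m → AbelianGroup.Carrier G) →
    InKer G M x → AbelianGroup._≈_ G (x ℓ) (AbelianGroup.ε G)

-- M' is an extension of M with index set J = image of the order-preserving
-- map σ : [m] → J ⊆ [m']: for every abelian group G, π_J (x ↦ x ∘ σ)
-- restricts to an isomorphism ker_G M' → ker_G M.
IsExtension : ∀ {r m r' m'} → Mat r m → Mat r' m' → (Fin m → Fin m') → Set₁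
IsExtension {r} {m} {r'} {m'} M M' σ = (G : AbelianGroup 0ℓ 0ℓ) →
  let open AbelianGroup G renaming (Carrier to A) in
  ((x : Fin m' → A) → InKer G M' x → InKer G M (λ j → x (σ j))) ×
  ((x y : Fin m' → A) → InKer G M' x → InKer G M' y →
     (∀ j → x (σ j) ≈ y (σ j)) → ∀ j → x j ≈ y j) ×
  ((y : Fin m → A) → InKer G M y →
     Σ (Fin m' → A) λ x → InKer G M' x × (∀ j → x (σ j) ≈ y j))

-- Since d_r(M) = 1, ker M is a direct summand of ℤᵐ: by induction on the rows one
-- builds N, L, R with M N = 0, L N = I and N L + R M = I.  The induction step
-- clears the new row against the kernel basis of the remaining rows by Bézout
-- column operations, leaving a pivot g that divides every maximal minor of M and is
-- therefore a unit.  For any abelian group G, ker_G (I | −N) = {(N y, y)} then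
-- projects isomorphically onto ker_G M, with inverse x ↦ (x, L x); and if row i of N
-- vanished, every x ∈ ker_G M would satisfy x_i = (N L x)_i = 0, making M plain.
-- So U = I and B = −N.

module Submission where

open import Level using (0ℓ)
open import Defs
open import Data.Nat as ℕ using (ℕ; zero; suc; z≤n; s≤s; _∸_)
import Data.Nat.Properties as ℕₚ
import Data.Nat.Divisibility as ℕ∣
import Data.Integer.Divisibility.Signed as ℤ∣
open import Data.Integer using (ℤ; +_; -[1+_]; 0ℤ; 1ℤ; -1ℤ; ∣_∣; _+_; _*_; -_; _-_)
open import Data.Integer.Properties
open import Data.Integer.Tactic.RingSolver using (solve-∀)
open import Data.Nat.Tactic.RingSolver using () renaming (solve-∀ to ℕ-solve-∀)
open import Data.Nat.GCD using (module GCD) renaming (module Bézout to ℕ-Bézout)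
open import Data.Fin as Fin using (Fin; zero; suc; punchIn; toℕ; _↑ˡ_; _↑ʳ_)
import Data.Fin.Properties as Finₚ
open import Data.Sum using (inj₁; inj₂)
open import Data.Product using (Σ; _×_; _,_; proj₁; proj₂)
open import Data.Vec.Functional using ([]; _∷_; tail; _++_; replicate)
open import Data.Vec.Functional.Properties using (lookup-++ˡ; lookup-++ʳ)
open import Function using (_∘_; id)
open import Relation.Binary.PropositionalEquality
  using (_≡_; _≢_; _≗_; refl; sym; trans; cong; cong₂; subst; subst₂; module ≡-Reasoning)
open import Relation.Binary.Bundles using (Setoid)
open import Algebra.Bundles using (AbelianGroup)
import Relation.Binary.Reasoning.Setoid as SetoidReasoning
open import Relation.Nullary using (¬_; yes; no)
open import Data.Empty using (⊥-elim)

sumℤ-cong : ∀ n {f g : Fin n → ℤ} → f ≗ g → sumℤ n f ≡ sumℤ n g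
sumℤ-cong zero    f≗g = refl
sumℤ-cong (suc n) f≗g = cong₂ _+_ (f≗g zero) (sumℤ-cong n (f≗g ∘ suc))

sumℤ-zero : ∀ n {f : Fin n → ℤ} → (∀ i → f i ≡ 0ℤ) → sumℤ n f ≡ 0ℤ
sumℤ-zero zero    f≡0 = refl
sumℤ-zero (suc n) f≡0 = cong₂ _+_ (f≡0 zero) (sumℤ-zero n (f≡0 ∘ suc))

sumℤ-distrib-+ : ∀ n (f g : Fin n → ℤ) → sumℤ n (λ i → f i + g i) ≡ sumℤ n f + sumℤ n g
sumℤ-distrib-+ zero    f g = refl
sumℤ-distrib-+ (suc n) f g = begin
  (f zero + g zero) + sumℤ n (λ i → f (suc i) + g (suc i))
    ≡⟨ cong (_+_ (f zero + g zero)) (sumℤ-distrib-+ n (f ∘ suc) (g ∘ suc)) ⟩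
  (f zero + g zero) + (sumℤ n (f ∘ suc) + sumℤ n (g ∘ suc))
    ≡⟨ +-interchange (f zero) (g zero) _ _ ⟩
  (f zero + sumℤ n (f ∘ suc)) + (g zero + sumℤ n (g ∘ suc)) ∎
  where
  open ≡-Reasoning
  +-interchange : ∀ a b c d → (a + b) + (c + d) ≡ (a + c) + (b + d)
  +-interchange = solve-∀

*-distribˡ-sumℤ : ∀ n c (f : Fin n → ℤ) → c * sumℤ n f ≡ sumℤ n (λ i → c * f i)
*-distribˡ-sumℤ zero    c f = *-zeroʳ c
*-distribˡ-sumℤ (suc n) c f =
  trans (*-distribˡ-+ c (f zero) _) (cong (_+_ (c * f zero)) (*-distribˡ-sumℤ n c (f ∘ suc)))

*-distribʳ-sumℤ : ∀ n c (f : Fin n → ℤ) → sumℤ n f * c ≡ sumℤ n (λ i → f i * c)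
*-distribʳ-sumℤ n c f =
  trans (*-comm _ c) (trans (*-distribˡ-sumℤ n c f) (sumℤ-cong n (λ i → *-comm c (f i))))

sumℤ-comm : ∀ n k (F : Fin n → Fin k → ℤ) →
  sumℤ n (λ i → sumℤ k (F i)) ≡ sumℤ k (λ j → sumℤ n (λ i → F i j))
sumℤ-comm zero    k F = sym (sumℤ-zero k (λ _ → refl))
sumℤ-comm (suc n) k F =
  trans (cong (_+_ (sumℤ k (F zero))) (sumℤ-comm n k (F ∘ suc)))
        (sym (sumℤ-distrib-+ k (F zero) _))

sumℤ-punchIn : ∀ n (a : Fin (suc n)) (f : Fin (suc n) → ℤ) →
  sumℤ (suc n) f ≡ f a + sumℤ n (f ∘ punchIn a)
sumℤ-punchIn n       zero    f = refl
sumℤ-punchIn (suc n) (suc a) f =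
  trans (cong (_+_ (f zero)) (sumℤ-punchIn n a (f ∘ suc))) (+-swapˡ (f zero) (f (suc a)) _)
  where
  +-swapˡ : ∀ x y z → x + (y + z) ≡ y + (x + z)
  +-swapˡ = solve-∀

infix 4 _≋_
_≋_ : ∀ {a b} → Mat a b → Mat a b → Set
A ≋ B = ∀ i j → A i j ≡ B i j

≋-refl : ∀ {a b} {A : Mat a b} → A ≋ A
≋-refl i j = refl

≋-sym : ∀ {a b} {A B : Mat a b} → A ≋ B → B ≋ A
≋-sym A≋B i j = sym (A≋B i j)

≋-trans : ∀ {a b} {A B C : Mat a b} → A ≋ B → B ≋ C → A ≋ C
≋-trans A≋B B≋C i j = trans (A≋B i j) (B≋C i j)

≋-setoid : ℕ → ℕ → Setoid 0ℓ 0ℓ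
≋-setoid a b = record
  { Carrier       = Mat a b
  ; _≈_           = _≋_
  ; isEquivalence = record { refl = ≋-refl ; sym = ≋-sym ; trans = ≋-trans }
  }

module ≋-Reasoning {a b : ℕ} = SetoidReasoning (≋-setoid a b)

_+ᴹ_ : ∀ {a b} → Mat a b → Mat a b → Mat a b
(A +ᴹ B) i j = A i j + B i j

infix 25 -ᴹ_
-ᴹ_ : ∀ {a b} → Mat a b → Mat a b
(-ᴹ A) i j = - A i j

0ᴹ : ∀ {a b} → Mat a b
0ᴹ i j = 0ℤ

⊗-cong : ∀ {a b c} {A A′ : Mat a b} {B B′ : Mat b c} → A ≋ A′ → B ≋ B′ → A ⊗ B ≋ A′ ⊗ B′
⊗-cong {b = b} A≋A′ B≋B′ i k = sumℤ-cong b (λ j → cong₂ _*_ (A≋A′ i j) (B≋B′ j k))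

⊗-congˡ : ∀ {a b c} {A A′ : Mat a b} (B : Mat b c) → A ≋ A′ → A ⊗ B ≋ A′ ⊗ B
⊗-congˡ B A≋A′ = ⊗-cong A≋A′ (≋-refl {A = B})

⊗-congʳ : ∀ {a b c} (A : Mat a b) {B B′ : Mat b c} → B ≋ B′ → A ⊗ B ≋ A ⊗ B′
⊗-congʳ A B≋B′ = ⊗-cong (≋-refl {A = A}) B≋B′

⊗-assoc : ∀ {a b c d} (A : Mat a b) (B : Mat b c) (C : Mat c d) → (A ⊗ B) ⊗ C ≋ A ⊗ (B ⊗ C)
⊗-assoc {b = b} {c} A B C i l = begin
  sumℤ c (λ k → sumℤ b (λ j → A i j * B j k) * C k l)
    ≡⟨ sumℤ-cong c (λ k → *-distribʳ-sumℤ b (C k l) (λ j → A i j * B j k)) ⟩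
  sumℤ c (λ k → sumℤ b (λ j → A i j * B j k * C k l))
    ≡⟨ sumℤ-comm c b (λ k j → A i j * B j k * C k l) ⟩
  sumℤ b (λ j → sumℤ c (λ k → A i j * B j k * C k l))
    ≡⟨ sumℤ-cong b (λ j → sumℤ-cong c (λ k → *-assoc (A i j) (B j k) (C k l))) ⟩
  sumℤ b (λ j → sumℤ c (λ k → A i j * (B j k * C k l)))
    ≡⟨ sumℤ-cong b (λ j → sym (*-distribˡ-sumℤ c (A i j) (λ k → B j k * C k l))) ⟩
  sumℤ b (λ j → A i j * sumℤ c (λ k → B j k * C k l)) ∎
  where open ≡-Reasoning

⊗-distribˡ-+ᴹ : ∀ {a b c} (A : Mat a b) (B C : Mat b c) → A ⊗ (B +ᴹ C) ≋ (A ⊗ B) +ᴹ (A ⊗ C)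
⊗-distribˡ-+ᴹ {b = b} A B C i k =
  trans (sumℤ-cong b (λ j → *-distribˡ-+ (A i j) (B j k) (C j k))) (sumℤ-distrib-+ b _ _)

⊗-zeroˡ : ∀ {a b c} (A : Mat b c) → 0ᴹ {a} {b} ⊗ A ≋ 0ᴹ
⊗-zeroˡ {b = b} A i k = sumℤ-zero b (λ j → *-zeroˡ (A j k))

Iₘ-suc : ∀ n (i j : Fin n) → Iₘ (suc n) (suc i) (suc j) ≡ Iₘ n i j
Iₘ-suc n i j with i Fin.≟ j
... | yes refl = refl
... | no  _    = refl

sumℤ-Iₘˡ : ∀ n (j : Fin n) (f : Fin n → ℤ) → sumℤ n (λ i → Iₘ n i j * f i) ≡ f j
sumℤ-Iₘˡ (suc n) zero f =
  trans (cong₂ _+_ (*-identityˡ (f zero)) (sumℤ-zero n (λ i → *-zeroˡ (f (suc i))))) (+-identityʳ _)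
sumℤ-Iₘˡ (suc n) (suc j) f =
  trans (cong (_+_ 0ℤ) (trans (sumℤ-cong n (λ i → cong (_* f (suc i)) (Iₘ-suc n i j)))
                              (sumℤ-Iₘˡ n j (f ∘ suc))))
        (+-identityˡ _)

sumℤ-Iₘʳ : ∀ n (i : Fin n) (f : Fin n → ℤ) → sumℤ n (λ j → f j * Iₘ n i j) ≡ f i
sumℤ-Iₘʳ (suc n) zero f =
  trans (cong₂ _+_ (*-identityʳ (f zero)) (sumℤ-zero n (λ j → *-zeroʳ (f (suc j))))) (+-identityʳ _)
sumℤ-Iₘʳ (suc n) (suc i) f =
  trans (cong₂ _+_ (*-zeroʳ (f zero)) (trans (sumℤ-cong n (λ j → cong (f (suc j) *_) (Iₘ-suc n i j)))
                                            (sumℤ-Iₘʳ n i (f ∘ suc))))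
        (+-identityˡ _)

⊗-identityˡ : ∀ {a b} (A : Mat a b) → Iₘ a ⊗ A ≋ A
⊗-identityˡ {a} A i k = trans (sumℤ-cong a (λ j → *-comm (Iₘ a i j) (A j k))) (sumℤ-Iₘʳ a i (λ j → A j k))

⊗-identityʳ : ∀ {a b} (A : Mat a b) → A ⊗ Iₘ b ≋ A
⊗-identityʳ {b = b} A i k = trans (sumℤ-cong b (λ j → *-comm (A i j) (Iₘ b j k))) (sumℤ-Iₘˡ b k (A i))

det-cong : ∀ n {A B : Mat n n} → A ≋ B → det n A ≡ det n B
det-cong zero    A≋B = refl
det-cong (suc n) A≋B = sumℤ-cong (suc n) λ j →
  cong (alt (toℕ j) *_) (cong₂ _*_ (A≋B zero j) (det-cong n (λ i k → A≋B (suc i) (punchIn j k))))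

det-Iₘ : ∀ n → det n (Iₘ n) ≡ 1ℤ
det-Iₘ zero    = refl
det-Iₘ (suc n) = begin
  det (suc n) (Iₘ (suc n))
    ≡⟨ cong₂ _+_ (trans (*-identityˡ _) (trans (*-identityˡ _) (det-cong n (Iₘ-suc n))))
                 (sumℤ-zero n (λ j → *-zeroʳ (alt (toℕ (suc j))))) ⟩
  det n (Iₘ n) + 0ℤ
    ≡⟨ +-identityʳ _ ⟩
  det n (Iₘ n)
    ≡⟨ det-Iₘ n ⟩
  1ℤ ∎
  where open ≡-Reasoning

-- The position of b in Fin (2 + n) ∖ {a}; the value at b = a is junk.
punchOut′ : ∀ {n} → Fin (suc (suc n)) → Fin (suc (suc n)) → Fin (suc n)
punchOut′         zero    zero    = zero
punchOut′         zero    (suc b) = b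
punchOut′         (suc a) zero    = zero
punchOut′ {zero}  (suc a) (suc b) = zero
punchOut′ {suc n} (suc a) (suc b) = suc (punchOut′ a b)

punchOut′-punchIn : ∀ {n} (a : Fin (suc (suc n))) (k : Fin (suc n)) → punchOut′ a (punchIn a k) ≡ k
punchOut′-punchIn         zero    k       = refl
punchOut′-punchIn         (suc a) zero    = refl
punchOut′-punchIn {suc n} (suc a) (suc k) = cong suc (punchOut′-punchIn a k)

punchIn-punchOut′-comm : ∀ {n} (a b : Fin (suc (suc n))) → a ≢ b →
  punchIn a ∘ punchIn (punchOut′ a b) ≗ punchIn b ∘ punchIn (punchOut′ b a)
punchIn-punchOut′-comm         zero    zero    a≢b l       = ⊥-elim (a≢b refl)
punchIn-punchOut′-comm         zero    (suc b) a≢b l       = refl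
punchIn-punchOut′-comm         (suc a) zero    a≢b l       = refl
punchIn-punchOut′-comm {suc n} (suc a) (suc b) a≢b zero    = refl
punchIn-punchOut′-comm {suc n} (suc a) (suc b) a≢b (suc l) =
  cong suc (punchIn-punchOut′-comm a b (a≢b ∘ cong suc) l)

alt-punchOut′-antisym : ∀ {n} (a b : Fin (suc (suc n))) → a ≢ b →
  alt (toℕ a) * alt (toℕ (punchOut′ a b)) ≡ - (alt (toℕ b) * alt (toℕ (punchOut′ b a)))
alt-punchOut′-antisym         zero    zero    a≢b = ⊥-elim (a≢b refl)
alt-punchOut′-antisym         zero    (suc b) a≢b = 1*x≡-[-x*1] (alt (toℕ b))
  where
  1*x≡-[-x*1] : ∀ x → 1ℤ * x ≡ - (- x * 1ℤ)
  1*x≡-[-x*1] = solve-∀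
alt-punchOut′-antisym         (suc a) zero    a≢b = -x*1≡-[1*x] (alt (toℕ a))
  where
  -x*1≡-[1*x] : ∀ x → - x * 1ℤ ≡ - (1ℤ * x)
  -x*1≡-[1*x] = solve-∀
alt-punchOut′-antisym {zero}  (suc zero) (suc zero) a≢b = ⊥-elim (a≢b refl)
alt-punchOut′-antisym {suc n} (suc a) (suc b) a≢b = begin
  - alt (toℕ a) * - alt (toℕ (punchOut′ a b))  ≡⟨ neg-*-neg (alt (toℕ a)) _ ⟩
  alt (toℕ a) * alt (toℕ (punchOut′ a b))      ≡⟨ alt-punchOut′-antisym a b (a≢b ∘ cong suc) ⟩
  - (alt (toℕ b) * alt (toℕ (punchOut′ b a)))  ≡⟨ cong -_ (neg-*-neg (alt (toℕ b)) _) ⟨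
  - (- alt (toℕ b) * - alt (toℕ (punchOut′ b a))) ∎
  where
  open ≡-Reasoning
  neg-*-neg : ∀ x y → - x * - y ≡ x * y
  neg-*-neg = solve-∀

sumℤ-offDiagonal : ∀ n (F : Fin (suc n) → Fin (suc n) → ℤ) → ℤ
sumℤ-offDiagonal n F = sumℤ (suc n) (λ a → sumℤ n (F a ∘ punchIn a))

-- Both sides of the identity are read off the full double sum of F a b + G b a.
sumℤ-offDiagonal-antisym : ∀ n (F G : Fin (suc n) → Fin (suc n) → ℤ) →
  (∀ a b → a ≢ b → F a b + G b a ≡ 0ℤ) →
  sumℤ-offDiagonal n F + sumℤ-offDiagonal n G ≡ 0ℤ
sumℤ-offDiagonal-antisym n F G FG≡0 =
  cancel (diag F) (diag G) (sumℤ-offDiagonal n F) (sumℤ-offDiagonal n G) (begin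
  (diag F + sumℤ-offDiagonal n F) + (diag G + sumℤ-offDiagonal n G)
    ≡⟨ cong₂ _+_ (full≡diag+off F) (full≡diag+off G) ⟨
  full F + full G
    ≡⟨ cong (_+_ (full F)) (sumℤ-comm (suc n) (suc n) G) ⟩
  full F + sumℤ (suc n) (λ a → sumℤ (suc n) (λ b → G b a))
    ≡⟨ sumℤ-distrib-+ (suc n) (λ a → sumℤ (suc n) (F a)) (λ a → sumℤ (suc n) (λ b → G b a)) ⟨
  sumℤ (suc n) (λ a → sumℤ (suc n) (F a) + sumℤ (suc n) (λ b → G b a))
    ≡⟨ sumℤ-cong (suc n) (λ a → sumℤ-distrib-+ (suc n) (F a) (λ b → G b a)) ⟨
  full H
    ≡⟨ full≡diag+off H ⟩
  sumℤ (suc n) (λ a → F a a + G a a) + sumℤ-offDiagonal n H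
    ≡⟨ cong₂ _+_ (sumℤ-distrib-+ (suc n) (λ a → F a a) (λ a → G a a))
                 (sumℤ-zero (suc n) (λ a → sumℤ-zero n (λ k →
                   FG≡0 a (punchIn a k) (Finₚ.punchInᵢ≢i a k ∘ sym)))) ⟩
  (diag F + diag G) + 0ℤ ∎)
  where
  open ≡-Reasoning
  H : Fin (suc n) → Fin (suc n) → ℤ
  H a b = F a b + G b a
  diag full : (Fin (suc n) → Fin (suc n) → ℤ) → ℤ
  diag K = sumℤ (suc n) (λ a → K a a)
  full K = sumℤ (suc n) (λ a → sumℤ (suc n) (K a))
  full≡diag+off : ∀ K → full K ≡ diag K + sumℤ-offDiagonal n K
  full≡diag+off K = trans (sumℤ-cong (suc n) (λ a → sumℤ-punchIn n a (K a)))
                          (sumℤ-distrib-+ (suc n) (λ a → K a a) (λ a → sumℤ n (K a ∘ punchIn a)))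
  cancel : ∀ p q s t → (p + s) + (q + t) ≡ (p + q) + 0ℤ → s + t ≡ 0ℤ
  cancel p q s t eq = begin
    s + t                               ≡⟨ regroup p q s t ⟩
    ((p + s) + (q + t)) - (p + q)       ≡⟨ cong (_- (p + q)) eq ⟩
    ((p + q) + 0ℤ) - (p + q)            ≡⟨ [x+0]-x≡0 (p + q) ⟩
    0ℤ                                  ∎
    where
    regroup : ∀ p q s t → s + t ≡ ((p + s) + (q + t)) - (p + q)
    regroup = solve-∀
    [x+0]-x≡0 : ∀ x → (x + 0ℤ) - x ≡ 0ℤ
    [x+0]-x≡0 = solve-∀

swap₀₁ : ∀ {n} → Mat (suc (suc n)) (suc (suc n)) → Mat (suc (suc n)) (suc (suc n))
swap₀₁ A zero          = A (suc zero)
swap₀₁ A (suc zero)    = A zero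
swap₀₁ A (suc (suc i)) = A (suc (suc i))

module Laplace₂ {n : ℕ} (A : Mat (suc (suc n)) (suc (suc n))) where

  sign₂ : Fin (suc (suc n)) → Fin (suc (suc n)) → ℤ
  sign₂ a b = alt (toℕ a) * alt (toℕ (punchOut′ a b))

  minor₂ : Fin (suc (suc n)) → Fin (suc (suc n)) → ℤ
  minor₂ a b = det n (λ i l → A (suc (suc i)) (punchIn a (punchIn (punchOut′ a b) l)))

  term : Fin (suc (suc n)) → Fin (suc (suc n)) → ℤ
  term a b = sign₂ a b * (A zero a * A (suc zero) b) * minor₂ a b

  det-expand₂ : det (suc (suc n)) A ≡ sumℤ-offDiagonal (suc n) term
  det-expand₂ = sumℤ-cong (suc (suc n)) λ a → begin
    alt (toℕ a) * (A zero a * sumℤ (suc n) (cofactorTerm a))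
      ≡⟨ cong (alt (toℕ a) *_) (*-distribˡ-sumℤ (suc n) (A zero a) (cofactorTerm a)) ⟩
    alt (toℕ a) * sumℤ (suc n) (λ k → A zero a * cofactorTerm a k)
      ≡⟨ *-distribˡ-sumℤ (suc n) (alt (toℕ a)) (λ k → A zero a * cofactorTerm a k) ⟩
    sumℤ (suc n) (λ k → alt (toℕ a) * (A zero a * cofactorTerm a k))
      ≡⟨ sumℤ-cong (suc n) (λ k → regroup (alt (toℕ a)) (alt (toℕ k)) (A zero a)
                                          (A (suc zero) (punchIn a k)) (complement a k)) ⟩
    sumℤ (suc n) (λ k → alt (toℕ a) * alt (toℕ k) * (A zero a * A (suc zero) (punchIn a k))
                          * complement a k)
      ≡⟨ sumℤ-cong (suc n) (λ k →
           cong (λ u → alt (toℕ a) * alt (toℕ u) * (A zero a * A (suc zero) (punchIn a k))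
                         * det n (λ i l → A (suc (suc i)) (punchIn a (punchIn u l))))
                (punchOut′-punchIn a k)) ⟨
    sumℤ (suc n) (term a ∘ punchIn a) ∎
    where
    open ≡-Reasoning
    complement : Fin (suc (suc n)) → Fin (suc n) → ℤ
    complement a k = det n (λ i l → A (suc (suc i)) (punchIn a (punchIn k l)))
    cofactorTerm : Fin (suc (suc n)) → Fin (suc n) → ℤ
    cofactorTerm a k = alt (toℕ k) * (A (suc zero) (punchIn a k) * complement a k)
    regroup : ∀ x y p q r → x * (p * (y * (q * r))) ≡ x * y * (p * q) * r
    regroup = solve-∀

-- In the expansions along the first two rows, the (a, b) term of A cancels the
-- (b, a) term of swap₀₁ A.
det-swap₀₁ : ∀ n (A : Mat (suc (suc n)) (suc (suc n))) →
  det (suc (suc n)) A + det (suc (suc n)) (swap₀₁ A) ≡ 0ℤ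
det-swap₀₁ n A = begin
  det (suc (suc n)) A + det (suc (suc n)) (swap₀₁ A)
    ≡⟨ cong₂ _+_ (Laplace₂.det-expand₂ A) (Laplace₂.det-expand₂ (swap₀₁ A)) ⟩
  sumℤ-offDiagonal (suc n) (Laplace₂.term A) + sumℤ-offDiagonal (suc n) (Laplace₂.term (swap₀₁ A))
    ≡⟨ sumℤ-offDiagonal-antisym (suc n) (Laplace₂.term A) (Laplace₂.term (swap₀₁ A)) cancels ⟩
  0ℤ ∎
  where
  open ≡-Reasoning
  cancels : ∀ a b → a ≢ b → Laplace₂.term A a b + Laplace₂.term (swap₀₁ A) b a ≡ 0ℤ
  cancels a b a≢b = begin
    Laplace₂.term A a b + Laplace₂.term (swap₀₁ A) b a
      ≡⟨ cong₂ (λ s m → s * (A zero a * A (suc zero) b) * m + Laplace₂.term (swap₀₁ A) b a)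
               (alt-punchOut′-antisym a b a≢b)
               (det-cong n (λ i l → cong (A (suc (suc i))) (punchIn-punchOut′-comm a b a≢b l))) ⟩
    - s * (x * y) * m + s * (y * x) * m
      ≡⟨ -sxym+syxm≡0 s x y m ⟩
    0ℤ ∎
    where
    s x y m : ℤ
    s = Laplace₂.sign₂ A b a
    x = A zero a
    y = A (suc zero) b
    m = Laplace₂.minor₂ A b a
    -sxym+syxm≡0 : ∀ s x y m → - s * (x * y) * m + s * (y * x) * m ≡ 0ℤ
    -sxym+syxm≡0 = solve-∀

x+x≡0⇒x≡0 : ∀ x → x + x ≡ 0ℤ → x ≡ 0ℤ
x+x≡0⇒x≡0 (+ zero)   _  = refl
x+x≡0⇒x≡0 (+ suc n)  ()
x+x≡0⇒x≡0 -[1+ n ]   ()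

det-equalRows₀ : ∀ n (A : Mat (suc n) (suc n)) t → A zero ≗ A (suc t) → det (suc n) A ≡ 0ℤ
det-equalRows₀ (suc n) A zero A₀≗A₁ = x+x≡0⇒x≡0 _ (begin
  det (suc (suc n)) A + det (suc (suc n)) A
    ≡⟨ cong (_+_ (det (suc (suc n)) A)) (det-cong (suc (suc n)) A≋swap) ⟩
  det (suc (suc n)) A + det (suc (suc n)) (swap₀₁ A)
    ≡⟨ det-swap₀₁ n A ⟩
  0ℤ ∎)
  where
  open ≡-Reasoning
  A≋swap : A ≋ swap₀₁ A
  A≋swap zero          = A₀≗A₁
  A≋swap (suc zero)    = sym ∘ A₀≗A₁
  A≋swap (suc (suc i)) = λ _ → refl
det-equalRows₀ (suc (suc n)) A (suc t) A₀≗Aₜ = begin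
  det (suc (suc (suc n))) A
    ≡⟨ +-identityʳ _ ⟨
  det (suc (suc (suc n))) A + 0ℤ
    ≡⟨ cong (_+_ (det (suc (suc (suc n))) A)) det-swap≡0 ⟨
  det (suc (suc (suc n))) A + det (suc (suc (suc n))) (swap₀₁ A)
    ≡⟨ det-swap₀₁ (suc n) A ⟩
  0ℤ ∎
  where
  open ≡-Reasoning
  -- After the swap, every minor along the first row contains the two equal rows.
  det-swap≡0 : det (suc (suc (suc n))) (swap₀₁ A) ≡ 0ℤ
  det-swap≡0 = sumℤ-zero (suc (suc (suc n))) λ j → begin
    alt (toℕ j) * (A (suc zero) j * det (suc (suc n)) (λ i k → swap₀₁ A (suc i) (punchIn j k)))
      ≡⟨ cong (λ d → alt (toℕ j) * (A (suc zero) j * d))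
              (det-equalRows₀ (suc n) (λ i k → swap₀₁ A (suc i) (punchIn j k)) t (A₀≗Aₜ ∘ punchIn j)) ⟩
    alt (toℕ j) * (A (suc zero) j * 0ℤ)
      ≡⟨ cong (alt (toℕ j) *_) (*-zeroʳ (A (suc zero) j)) ⟩
    alt (toℕ j) * 0ℤ
      ≡⟨ *-zeroʳ (alt (toℕ j)) ⟩
    0ℤ ∎

det-linear₀ : ∀ n (R : Mat n (suc n)) k (c : Fin k → ℤ) (W : Mat k (suc n)) →
  det (suc n) ((λ j → sumℤ k (λ t → c t * W t j)) ∷ R) ≡ sumℤ k (λ t → c t * det (suc n) (W t ∷ R))
det-linear₀ n R k c W = begin
  sumℤ (suc n) (λ j → alt (toℕ j) * (sumℤ k (λ t → c t * W t j) * C j))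
    ≡⟨ sumℤ-cong (suc n) distribute ⟩
  sumℤ (suc n) (λ j → sumℤ k (λ t → c t * (alt (toℕ j) * (W t j * C j))))
    ≡⟨ sumℤ-comm (suc n) k (λ j t → c t * (alt (toℕ j) * (W t j * C j))) ⟩
  sumℤ k (λ t → sumℤ (suc n) (λ j → c t * (alt (toℕ j) * (W t j * C j))))
    ≡⟨ sumℤ-cong k (λ t → *-distribˡ-sumℤ (suc n) (c t) (λ j → alt (toℕ j) * (W t j * C j))) ⟨
  sumℤ k (λ t → c t * det (suc n) (W t ∷ R)) ∎
  where
  open ≡-Reasoning
  C : Fin (suc n) → ℤ
  C j = det n (λ i l → R i (punchIn j l))
  distribute : ∀ j → alt (toℕ j) * (sumℤ k (λ t → c t * W t j) * C j)
                   ≡ sumℤ k (λ t → c t * (alt (toℕ j) * (W t j * C j)))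
  distribute j = begin
    alt (toℕ j) * (sumℤ k (λ t → c t * W t j) * C j)
      ≡⟨ cong (alt (toℕ j) *_) (*-distribʳ-sumℤ k (C j) (λ t → c t * W t j)) ⟩
    alt (toℕ j) * sumℤ k (λ t → c t * W t j * C j)
      ≡⟨ *-distribˡ-sumℤ k (alt (toℕ j)) (λ t → c t * W t j * C j) ⟩
    sumℤ k (λ t → alt (toℕ j) * (c t * W t j * C j))
      ≡⟨ sumℤ-cong k (λ t → regroup (alt (toℕ j)) (c t) (W t j) (C j)) ⟩
    sumℤ k (λ t → c t * (alt (toℕ j) * (W t j * C j))) ∎
    where
    regroup : ∀ a c w d → a * (c * w * d) ≡ c * (a * (w * d))
    regroup = solve-∀

det-row₀-combination : ∀ n (A : Mat (suc n) (suc n)) g (w : Fin (suc n) → ℤ) (c : Fin n → ℤ) →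
  (∀ j → A zero j ≡ g * w j + sumℤ n (λ t → c t * A (suc t) j)) →
  det (suc n) A ≡ g * det (suc n) (w ∷ tail A)
det-row₀-combination n A g w c A₀≡ = begin
  det (suc n) A
    ≡⟨ det-cong (suc n) A≋ ⟩
  det (suc n) ((λ j → sumℤ (suc n) (λ t → (g ∷ c) t * (w ∷ tail A) t j)) ∷ tail A)
    ≡⟨ det-linear₀ n (tail A) (suc n) (g ∷ c) (w ∷ tail A) ⟩
  g * det (suc n) (w ∷ tail A) + sumℤ n (λ t → c t * det (suc n) (A (suc t) ∷ tail A))
    ≡⟨ cong (_+_ (g * det (suc n) (w ∷ tail A))) (sumℤ-zero n (λ t →
         trans (cong (c t *_) (det-equalRows₀ n (A (suc t) ∷ tail A) t (λ _ → refl))) (*-zeroʳ (c t)))) ⟩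
  g * det (suc n) (w ∷ tail A) + 0ℤ
    ≡⟨ +-identityʳ _ ⟩
  g * det (suc n) (w ∷ tail A) ∎
  where
  open ≡-Reasoning
  A≋ : A ≋ (λ j → sumℤ (suc n) (λ t → (g ∷ c) t * (w ∷ tail A) t j)) ∷ tail A
  A≋ zero    = A₀≡
  A≋ (suc i) = λ _ → refl

record Bézout (a b : ℤ) : Set where
  field
    d p q s t : ℤ
    a≡d*p     : a ≡ d * p
    b≡d*q     : b ≡ d * q
    s*p+t*q≡1 : s * p + t * q ≡ 1ℤ

identity-cancel : ∀ d p q .{{_ : ℕ.NonZero d}} →
  ℕ-Bézout.Identity d (p ℕ.* d) (q ℕ.* d) → ℕ-Bézout.Identity 1 p q
identity-cancel d p q (ℕ-Bézout.+- x y eq) = ℕ-Bézout.+- x y (ℕₚ.*-cancelʳ-≡ _ _ d (begin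
  (1 ℕ.+ y ℕ.* q) ℕ.* d  ≡⟨ expand d y q ⟩
  d ℕ.+ y ℕ.* (q ℕ.* d)  ≡⟨ eq ⟩
  x ℕ.* (p ℕ.* d)        ≡⟨ ℕₚ.*-assoc x p d ⟨
  x ℕ.* p ℕ.* d          ∎))
  where
  open ≡-Reasoning
  expand : ∀ d y q → (1 ℕ.+ y ℕ.* q) ℕ.* d ≡ d ℕ.+ y ℕ.* (q ℕ.* d)
  expand = ℕ-solve-∀
identity-cancel d p q (ℕ-Bézout.-+ x y eq) =
  ℕ-Bézout.Identity.sym (identity-cancel d q p (ℕ-Bézout.+- y x eq))

identity⇒ℤ : ∀ {p q} → ℕ-Bézout.Identity 1 p q → Σ ℤ λ s → Σ ℤ λ t → s * + p + t * + q ≡ 1ℤ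
identity⇒ℤ {p} {q} (ℕ-Bézout.+- x y eq) = + x , - + y , (begin
  + x * + p + - + y * + q              ≡⟨ cong (_+ - + y * + q) xp≡1+yq ⟩
  1ℤ + + y * + q + - + y * + q         ≡⟨ cancel (+ y) (+ q) ⟩
  1ℤ                                   ∎)
  where
  open ≡-Reasoning
  xp≡1+yq : + x * + p ≡ 1ℤ + + y * + q
  xp≡1+yq = begin
    + x * + p             ≡⟨ pos-* x p ⟨
    + (x ℕ.* p)           ≡⟨ cong +_ eq ⟨
    + (1 ℕ.+ y ℕ.* q)     ≡⟨ pos-+ 1 (y ℕ.* q) ⟩
    1ℤ + + (y ℕ.* q)      ≡⟨ cong (_+_ 1ℤ) (pos-* y q) ⟩
    1ℤ + + y * + q        ∎
  cancel : ∀ b c → 1ℤ + b * c + - b * c ≡ 1ℤ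
  cancel = solve-∀
identity⇒ℤ {p} {q} (ℕ-Bézout.-+ x y eq) with identity⇒ℤ (ℕ-Bézout.+- y x eq)
... | s , t , sq+tp≡1 = t , s , trans (+-comm (t * + p) (s * + q)) sq+tp≡1

bézout-ℕ : ∀ m n → Bézout (+ m) (+ n)
bézout-ℕ m n with ℕ-Bézout.lemma m n
... | ℕ-Bézout.result d gcd identity with GCD.gcd∣m gcd | GCD.gcd∣n gcd
... | ℕ∣.divides p refl | ℕ∣.divides q refl = scaled d identity
  where
  scaled : ∀ d → ℕ-Bézout.Identity d (p ℕ.* d) (q ℕ.* d) → Bézout (+ (p ℕ.* d)) (+ (q ℕ.* d))
  scaled zero    _        = record
    { d = 0ℤ ; p = 1ℤ ; q = 0ℤ ; s = 1ℤ ; t = 0ℤ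
    ; a≡d*p = cong +_ (ℕₚ.*-zeroʳ p) ; b≡d*q = cong +_ (ℕₚ.*-zeroʳ q) ; s*p+t*q≡1 = refl }
  scaled (suc d) identity with identity⇒ℤ (identity-cancel (suc d) p q identity)
  ... | s , t , sp+tq≡1 = record
    { d = + suc d ; p = + p ; q = + q ; s = s ; t = t
    ; a≡d*p = trans (pos-* p (suc d)) (*-comm (+ p) (+ suc d))
    ; b≡d*q = trans (pos-* q (suc d)) (*-comm (+ q) (+ suc d))
    ; s*p+t*q≡1 = sp+tq≡1 }

bézout-unit-scale : ∀ {a b} σ τ → σ * σ ≡ 1ℤ → τ * τ ≡ 1ℤ → Bézout a b → Bézout (σ * a) (τ * b)
bézout-unit-scale σ τ σ²≡1 τ²≡1 B = record
  { d = d ; p = σ * p ; q = τ * q ; s = s * σ ; t = t * τ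
  ; a≡d*p = trans (cong (σ *_) a≡d*p) (swap σ d p)
  ; b≡d*q = trans (cong (τ *_) b≡d*q) (swap τ d q)
  ; s*p+t*q≡1 = begin
      s * σ * (σ * p) + t * τ * (τ * q)          ≡⟨ regroup s σ p t τ q ⟩
      σ * σ * (s * p) + τ * τ * (t * q)          ≡⟨ cong₂ (λ u v → u * (s * p) + v * (t * q))
                                                           σ²≡1 τ²≡1 ⟩
      1ℤ * (s * p) + 1ℤ * (t * q)                ≡⟨ cong₂ _+_ (*-identityˡ (s * p)) (*-identityˡ (t * q)) ⟩
      s * p + t * q                              ≡⟨ s*p+t*q≡1 ⟩
      1ℤ                                         ∎ }
  where
  open Bézout B
  open ≡-Reasoning
  swap : ∀ σ d p → σ * (d * p) ≡ d * (σ * p)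
  swap = solve-∀
  regroup : ∀ s σ p t τ q → s * σ * (σ * p) + t * τ * (τ * q) ≡ σ * σ * (s * p) + τ * τ * (t * q)
  regroup = solve-∀

unit-sign : ∀ a → Σ ℤ λ σ → σ * σ ≡ 1ℤ × a ≡ σ * + ∣ a ∣
unit-sign (+ n)    = 1ℤ , refl , sym (*-identityˡ (+ n))
unit-sign -[1+ n ] = -1ℤ , refl , sym (-1*i≡-i (+ suc n))

bézout : ∀ a b → Bézout a b
bézout a b with unit-sign a | unit-sign b
... | σ , σ²≡1 , a≡σ∣a∣ | τ , τ²≡1 , b≡τ∣b∣ =
  subst₂ Bézout (sym a≡σ∣a∣) (sym b≡τ∣b∣)
         (bézout-unit-scale σ τ σ²≡1 τ²≡1 (bézout-ℕ ∣ a ∣ ∣ b ∣))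

sumℤ-↑ : ∀ a b (f : Fin (a ℕ.+ b) → ℤ) →
  sumℤ (a ℕ.+ b) f ≡ sumℤ a (f ∘ (_↑ˡ b)) + sumℤ b (f ∘ (a ↑ʳ_))
sumℤ-↑ zero    b f = sym (+-identityˡ _)
sumℤ-↑ (suc a) b f =
  trans (cong (_+_ (f zero)) (sumℤ-↑ a b (f ∘ suc))) (sym (+-assoc (f zero) _ _))

↑-ind : ∀ a b (P : Fin (a ℕ.+ b) → Set) →
  (∀ i → P (i ↑ˡ b)) → (∀ j → P (a ↑ʳ j)) → ∀ i → P i
↑-ind zero    b P Pˡ Pʳ i       = Pʳ i
↑-ind (suc a) b P Pˡ Pʳ zero    = Pˡ zero
↑-ind (suc a) b P Pˡ Pʳ (suc i) = ↑-ind a b (P ∘ suc) (Pˡ ∘ suc) Pʳ i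

_⊕_ : ∀ {a b} → Mat a a → Mat b b → Mat (a ℕ.+ b) (a ℕ.+ b)
_⊕_ {a} {b} A B = (λ i → A i ++ replicate b 0ℤ) ++ (λ i → replicate a 0ℤ ++ B i)

module _ {a b} (A : Mat a a) (B : Mat b b) where

  private
    upper : Fin a → Fin (a ℕ.+ b) → ℤ
    upper i = A i ++ replicate b 0ℤ
    lower : Fin b → Fin (a ℕ.+ b) → ℤ
    lower i = replicate a 0ℤ ++ B i

  ⊕-↑ˡ↑ˡ : ∀ i j → (A ⊕ B) (i ↑ˡ b) (j ↑ˡ b) ≡ A i j
  ⊕-↑ˡ↑ˡ i j = trans (cong (λ row → row (j ↑ˡ b)) (lookup-++ˡ upper lower i))
                     (lookup-++ˡ (A i) _ j)

  ⊕-↑ˡ↑ʳ : ∀ i j → (A ⊕ B) (i ↑ˡ b) (a ↑ʳ j) ≡ 0ℤ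
  ⊕-↑ˡ↑ʳ i j = trans (cong (λ row → row (a ↑ʳ j)) (lookup-++ˡ upper lower i))
                     (lookup-++ʳ (A i) _ j)

  ⊕-↑ʳ↑ˡ : ∀ i j → (A ⊕ B) (a ↑ʳ i) (j ↑ˡ b) ≡ 0ℤ
  ⊕-↑ʳ↑ˡ i j = trans (cong (λ row → row (j ↑ˡ b)) (lookup-++ʳ upper lower i))
                     (lookup-++ˡ (replicate a 0ℤ) (B i) j)

  ⊕-↑ʳ↑ʳ : ∀ i j → (A ⊕ B) (a ↑ʳ i) (a ↑ʳ j) ≡ B i j
  ⊕-↑ʳ↑ʳ i j = trans (cong (λ row → row (a ↑ʳ j)) (lookup-++ʳ upper lower i))
                     (lookup-++ʳ (replicate a 0ℤ) (B i) j)

⊕-⊗ : ∀ {a b} (A C : Mat a a) (B D : Mat b b) → (A ⊕ B) ⊗ (C ⊕ D) ≋ (A ⊗ C) ⊕ (B ⊗ D)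
⊕-⊗ {a} {b} A C B D =
  ↑-ind a b _ (λ i → ↑-ind a b _ (ˡˡ i) (ˡʳ i)) (λ i → ↑-ind a b _ (ʳˡ i) (ʳʳ i))
  where
  open ≡-Reasoning
  X Y Z : Mat (a ℕ.+ b) (a ℕ.+ b)
  X = A ⊕ B
  Y = C ⊕ D
  Z = (A ⊗ C) ⊕ (B ⊗ D)
  halves : Fin (a ℕ.+ b) → Fin (a ℕ.+ b) → ℤ
  halves i k = sumℤ a (λ j → X i (j ↑ˡ b) * Y (j ↑ˡ b) k) + sumℤ b (λ j → X i (a ↑ʳ j) * Y (a ↑ʳ j) k)
  split : ∀ i k → (X ⊗ Y) i k ≡ halves i k
  split i k = sumℤ-↑ a b (λ j → X i j * Y j k)
  ˡˡ : ∀ i k → (X ⊗ Y) (i ↑ˡ b) (k ↑ˡ b) ≡ Z (i ↑ˡ b) (k ↑ˡ b)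
  ˡˡ i k = begin
    (X ⊗ Y) (i ↑ˡ b) (k ↑ˡ b)
      ≡⟨ split (i ↑ˡ b) (k ↑ˡ b) ⟩
    halves (i ↑ˡ b) (k ↑ˡ b)
      ≡⟨ cong₂ _+_ (sumℤ-cong a (λ j → cong₂ _*_ (⊕-↑ˡ↑ˡ A B i j) (⊕-↑ˡ↑ˡ C D j k)))
                   (sumℤ-zero b (λ j → cong₂ _*_ (⊕-↑ˡ↑ʳ A B i j) (⊕-↑ʳ↑ˡ C D j k))) ⟩
    (A ⊗ C) i k + 0ℤ
      ≡⟨ +-identityʳ _ ⟩
    (A ⊗ C) i k
      ≡⟨ ⊕-↑ˡ↑ˡ (A ⊗ C) (B ⊗ D) i k ⟨
    Z (i ↑ˡ b) (k ↑ˡ b) ∎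
  ˡʳ : ∀ i k → (X ⊗ Y) (i ↑ˡ b) (a ↑ʳ k) ≡ Z (i ↑ˡ b) (a ↑ʳ k)
  ˡʳ i k = begin
    (X ⊗ Y) (i ↑ˡ b) (a ↑ʳ k)
      ≡⟨ split (i ↑ˡ b) (a ↑ʳ k) ⟩
    halves (i ↑ˡ b) (a ↑ʳ k)
      ≡⟨ cong₂ _+_ (sumℤ-zero a (λ j → trans (cong₂ _*_ (⊕-↑ˡ↑ˡ A B i j) (⊕-↑ˡ↑ʳ C D j k))
                                             (*-zeroʳ (A i j))))
                   (sumℤ-zero b (λ j → cong (_* Y (a ↑ʳ j) (a ↑ʳ k)) (⊕-↑ˡ↑ʳ A B i j))) ⟩
    0ℤ
      ≡⟨ ⊕-↑ˡ↑ʳ (A ⊗ C) (B ⊗ D) i k ⟨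
    Z (i ↑ˡ b) (a ↑ʳ k) ∎
  ʳˡ : ∀ i k → (X ⊗ Y) (a ↑ʳ i) (k ↑ˡ b) ≡ Z (a ↑ʳ i) (k ↑ˡ b)
  ʳˡ i k = begin
    (X ⊗ Y) (a ↑ʳ i) (k ↑ˡ b)
      ≡⟨ split (a ↑ʳ i) (k ↑ˡ b) ⟩
    halves (a ↑ʳ i) (k ↑ˡ b)
      ≡⟨ cong₂ _+_ (sumℤ-zero a (λ j → cong (_* Y (j ↑ˡ b) (k ↑ˡ b)) (⊕-↑ʳ↑ˡ A B i j)))
                   (sumℤ-zero b (λ j → trans (cong₂ _*_ (⊕-↑ʳ↑ʳ A B i j) (⊕-↑ʳ↑ˡ C D j k))
                                             (*-zeroʳ (B i j)))) ⟩
    0ℤ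
      ≡⟨ ⊕-↑ʳ↑ˡ (A ⊗ C) (B ⊗ D) i k ⟨
    Z (a ↑ʳ i) (k ↑ˡ b) ∎
  ʳʳ : ∀ i k → (X ⊗ Y) (a ↑ʳ i) (a ↑ʳ k) ≡ Z (a ↑ʳ i) (a ↑ʳ k)
  ʳʳ i k = begin
    (X ⊗ Y) (a ↑ʳ i) (a ↑ʳ k)
      ≡⟨ split (a ↑ʳ i) (a ↑ʳ k) ⟩
    halves (a ↑ʳ i) (a ↑ʳ k)
      ≡⟨ cong₂ _+_ (sumℤ-zero a (λ j → cong₂ _*_ (⊕-↑ʳ↑ˡ A B i j) (⊕-↑ˡ↑ʳ C D j k)))
                   (sumℤ-cong b (λ j → cong₂ _*_ (⊕-↑ʳ↑ʳ A B i j) (⊕-↑ʳ↑ʳ C D j k))) ⟩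
    0ℤ + (B ⊗ D) i k
      ≡⟨ +-identityˡ _ ⟩
    (B ⊗ D) i k
      ≡⟨ ⊕-↑ʳ↑ʳ (A ⊗ C) (B ⊗ D) i k ⟨
    Z (a ↑ʳ i) (a ↑ʳ k) ∎

⊕-cong : ∀ {a b} {A A′ : Mat a a} {B B′ : Mat b b} → A ≋ A′ → B ≋ B′ → A ⊕ B ≋ A′ ⊕ B′
⊕-cong {a} A≋A′ B≋B′ i j with Fin.splitAt a i
... | inj₁ i′ with Fin.splitAt a j
...   | inj₁ j′ = A≋A′ i′ j′
...   | inj₂ _  = refl
⊕-cong {a} A≋A′ B≋B′ i j | inj₂ i′ with Fin.splitAt a j
...   | inj₁ _  = refl
...   | inj₂ j′ = B≋B′ i′ j′

Iₘ-↑ˡ↑ˡ : ∀ {a} b (i j : Fin a) → Iₘ (a ℕ.+ b) (i ↑ˡ b) (j ↑ˡ b) ≡ Iₘ a i j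
Iₘ-↑ˡ↑ˡ b zero    zero    = refl
Iₘ-↑ˡ↑ˡ b zero    (suc j) = refl
Iₘ-↑ˡ↑ˡ b (suc i) zero    = refl
Iₘ-↑ˡ↑ˡ {suc a} b (suc i) (suc j) =
  trans (Iₘ-suc _ (i ↑ˡ b) (j ↑ˡ b)) (trans (Iₘ-↑ˡ↑ˡ b i j) (sym (Iₘ-suc a i j)))

Iₘ-↑ʳ↑ʳ : ∀ a {b} (i j : Fin b) → Iₘ (a ℕ.+ b) (a ↑ʳ i) (a ↑ʳ j) ≡ Iₘ b i j
Iₘ-↑ʳ↑ʳ zero    i j = refl
Iₘ-↑ʳ↑ʳ (suc a) i j = trans (Iₘ-suc _ (a ↑ʳ i) (a ↑ʳ j)) (Iₘ-↑ʳ↑ʳ a i j)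

Iₘ-↑ˡ↑ʳ : ∀ {a b} (i : Fin a) (j : Fin b) → Iₘ (a ℕ.+ b) (i ↑ˡ b) (a ↑ʳ j) ≡ 0ℤ
Iₘ-↑ˡ↑ʳ zero    j = refl
Iₘ-↑ˡ↑ʳ {suc a} {b} (suc i) j = trans (Iₘ-suc _ (i ↑ˡ b) (a ↑ʳ j)) (Iₘ-↑ˡ↑ʳ i j)

Iₘ-↑ʳ↑ˡ : ∀ {a b} (i : Fin b) (j : Fin a) → Iₘ (a ℕ.+ b) (a ↑ʳ i) (j ↑ˡ b) ≡ 0ℤ
Iₘ-↑ʳ↑ˡ {b = b} i zero    = refl
Iₘ-↑ʳ↑ˡ {suc a} {b} i (suc j) = trans (Iₘ-suc _ (a ↑ʳ i) (j ↑ˡ b)) (Iₘ-↑ʳ↑ˡ i j)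

⊕-Iₘ : ∀ a b → Iₘ a ⊕ Iₘ b ≋ Iₘ (a ℕ.+ b)
⊕-Iₘ a b = ↑-ind a b _ (λ i → ↑-ind a b _ (ˡˡ i) (ˡʳ i)) (λ i → ↑-ind a b _ (ʳˡ i) (ʳʳ i))
  where
  I : Mat (a ℕ.+ b) (a ℕ.+ b)
  I = Iₘ a ⊕ Iₘ b
  ˡˡ : ∀ i j → I (i ↑ˡ b) (j ↑ˡ b) ≡ Iₘ (a ℕ.+ b) (i ↑ˡ b) (j ↑ˡ b)
  ˡˡ i j = trans (⊕-↑ˡ↑ˡ (Iₘ a) (Iₘ b) i j) (sym (Iₘ-↑ˡ↑ˡ b i j))
  ˡʳ : ∀ i j → I (i ↑ˡ b) (a ↑ʳ j) ≡ Iₘ (a ℕ.+ b) (i ↑ˡ b) (a ↑ʳ j)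
  ˡʳ i j = trans (⊕-↑ˡ↑ʳ (Iₘ a) (Iₘ b) i j) (sym (Iₘ-↑ˡ↑ʳ i j))
  ʳˡ : ∀ i j → I (a ↑ʳ i) (j ↑ˡ b) ≡ Iₘ (a ℕ.+ b) (a ↑ʳ i) (j ↑ˡ b)
  ʳˡ i j = trans (⊕-↑ʳ↑ˡ (Iₘ a) (Iₘ b) i j) (sym (Iₘ-↑ʳ↑ˡ i j))
  ʳʳ : ∀ i j → I (a ↑ʳ i) (a ↑ʳ j) ≡ Iₘ (a ℕ.+ b) (a ↑ʳ i) (a ↑ʳ j)
  ʳʳ i j = trans (⊕-↑ʳ↑ʳ (Iₘ a) (Iₘ b) i j) (sym (Iₘ-↑ʳ↑ʳ a i j))

record Invertible (n : ℕ) : Set where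
  field
    mat inv  : Mat n n
    inverseʳ : mat ⊗ inv ≋ Iₘ n
    inverseˡ : inv ⊗ mat ≋ Iₘ n

Iₘ-invertible : ∀ n → Invertible n
Iₘ-invertible n = record
  { mat = Iₘ n ; inv = Iₘ n ; inverseʳ = ⊗-identityˡ (Iₘ n) ; inverseˡ = ⊗-identityˡ (Iₘ n) }

⊗-cancel-middle : ∀ {a b c d} (A : Mat a b) (B : Mat b c) (C : Mat c b) (D : Mat b d) →
  B ⊗ C ≋ Iₘ b → (A ⊗ B) ⊗ (C ⊗ D) ≋ A ⊗ D
⊗-cancel-middle {b = b} A B C D B⊗C≋I = begin
  (A ⊗ B) ⊗ (C ⊗ D)  ≈⟨ ⊗-assoc A B (C ⊗ D) ⟩
  A ⊗ (B ⊗ (C ⊗ D))  ≈⟨ ⊗-congʳ A (⊗-assoc B C D) ⟨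
  A ⊗ ((B ⊗ C) ⊗ D)  ≈⟨ ⊗-congʳ A (⊗-congˡ D B⊗C≋I) ⟩
  A ⊗ (Iₘ b ⊗ D)     ≈⟨ ⊗-congʳ A (⊗-identityˡ D) ⟩
  A ⊗ D              ∎
  where open ≋-Reasoning

inverse-⊗ : ∀ {n} (A A′ B B′ : Mat n n) →
  A ⊗ A′ ≋ Iₘ n → B ⊗ B′ ≋ Iₘ n → (A ⊗ B) ⊗ (B′ ⊗ A′) ≋ Iₘ n
inverse-⊗ A A′ B B′ AA′≋I BB′≋I = ≋-trans (⊗-cancel-middle A B B′ A′ BB′≋I) AA′≋I

⊗-invertible : ∀ {n} → Invertible n → Invertible n → Invertible n
⊗-invertible P Q = record
  { mat = P.mat ⊗ Q.mat ; inv = Q.inv ⊗ P.inv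
  ; inverseʳ = inverse-⊗ P.mat P.inv Q.mat Q.inv P.inverseʳ Q.inverseʳ
  ; inverseˡ = inverse-⊗ Q.inv Q.mat P.inv P.mat Q.inverseˡ P.inverseˡ }
  where
  module P = Invertible P
  module Q = Invertible Q

⊕-invertible : ∀ {a b} → Invertible a → Invertible b → Invertible (a ℕ.+ b)
⊕-invertible {a} {b} P Q = record
  { mat = P.mat ⊕ Q.mat ; inv = P.inv ⊕ Q.inv
  ; inverseʳ = inverse P.mat P.inv Q.mat Q.inv P.inverseʳ Q.inverseʳ
  ; inverseˡ = inverse P.inv P.mat Q.inv Q.mat P.inverseˡ Q.inverseˡ }
  where
  module P = Invertible P
  module Q = Invertible Q
  open ≋-Reasoning
  inverse : ∀ A A′ B B′ → A ⊗ A′ ≋ Iₘ a → B ⊗ B′ ≋ Iₘ b →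
            (A ⊕ B) ⊗ (A′ ⊕ B′) ≋ Iₘ (a ℕ.+ b)
  inverse A A′ B B′ AA′≋I BB′≋I = begin
    (A ⊕ B) ⊗ (A′ ⊕ B′)    ≈⟨ ⊕-⊗ A A′ B B′ ⟩
    (A ⊗ A′) ⊕ (B ⊗ B′)    ≈⟨ ⊕-cong AA′≋I BB′≋I ⟩
    Iₘ a ⊕ Iₘ b            ≈⟨ ⊕-Iₘ a b ⟩
    Iₘ (a ℕ.+ b)           ∎

mat₂ : ℤ → ℤ → ℤ → ℤ → Mat 2 2
mat₂ a b c d = (a ∷ b ∷ []) ∷ (c ∷ d ∷ []) ∷ []

bézout-invertible : ∀ s t p q → s * p + t * q ≡ 1ℤ → Invertible 2
bézout-invertible s t p q sp+tq≡1 = record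
  { mat = mat₂ s (- q) t p ; inv = mat₂ p q (- t) s
  ; inverseʳ = λ where
      zero       zero       → trans (e₀₀ s t p q) sp+tq≡1
      zero       (suc zero) → e₀₁ s q
      (suc zero) zero       → e₁₀ t p
      (suc zero) (suc zero) → trans (e₁₁ s t p q) sp+tq≡1
  ; inverseˡ = λ where
      zero       zero       → trans (e′₀₀ s t p q) sp+tq≡1
      zero       (suc zero) → e′₀₁ p q
      (suc zero) zero       → e′₁₀ s t
      (suc zero) (suc zero) → trans (e′₁₁ s t p q) sp+tq≡1
  }
  where
  e₀₀ : ∀ s t p q → s * p + (- q * - t + 0ℤ) ≡ s * p + t * q
  e₀₀ = solve-∀
  e₀₁ : ∀ s q → s * q + (- q * s + 0ℤ) ≡ 0ℤ
  e₀₁ = solve-∀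
  e₁₀ : ∀ t p → t * p + (p * - t + 0ℤ) ≡ 0ℤ
  e₁₀ = solve-∀
  e₁₁ : ∀ s t p q → t * q + (p * s + 0ℤ) ≡ s * p + t * q
  e₁₁ = solve-∀
  e′₀₀ : ∀ s t p q → p * s + (q * t + 0ℤ) ≡ s * p + t * q
  e′₀₀ = solve-∀
  e′₀₁ : ∀ p q → p * - q + (q * p + 0ℤ) ≡ 0ℤ
  e′₀₁ = solve-∀
  e′₁₀ : ∀ s t → - t * s + (s * t + 0ℤ) ≡ 0ℤ
  e′₁₀ = solve-∀
  e′₁₁ : ∀ s t p q → - t * - q + (s * p + 0ℤ) ≡ s * p + t * q
  e′₁₁ = solve-∀

-- Q = (1 ⊕ Q′) (T ⊕ I), where Q′ reduces the tail of u and the Bézout matrix T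
-- then merges the first two entries.
row-reduction : ∀ n (u : Mat 1 (suc n)) →
  Σ (Invertible (suc n)) λ Q → ∀ j → (u ⊗ Invertible.mat Q) zero (suc j) ≡ 0ℤ
row-reduction zero    u = Iₘ-invertible 1 , λ ()
row-reduction (suc n) u with row-reduction n (λ _ j → u zero (suc j))
... | Q′ , Q′-reduces =
  ⊗-invertible (⊕-invertible (Iₘ-invertible 1) Q′) (⊕-invertible rotation (Iₘ-invertible n)) , reduces
  where
  module Q′ = Invertible Q′
  u′ : Mat 1 (suc n)
  u′ _ j = u zero (suc j)
  open Bézout (bézout (u zero zero) ((u′ ⊗ Q′.mat) zero zero))
  rotation : Invertible 2
  rotation = bézout-invertible s t p q s*p+t*q≡1
  w : Mat 1 (suc (suc n))
  w = u ⊗ (Iₘ 1 ⊕ Q′.mat)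
  w₀≡ : w zero zero ≡ d * p
  w₀≡ = trans (cong₂ _+_ (*-identityʳ (u zero zero)) (sumℤ-zero (suc n) (λ k → *-zeroʳ (u zero (suc k)))))
              (trans (+-identityʳ _) a≡d*p)
  w-suc≡ : ∀ k → w zero (suc k) ≡ (u′ ⊗ Q′.mat) zero k
  w-suc≡ k = trans (cong (_+ (u′ ⊗ Q′.mat) zero k) (*-zeroʳ (u zero zero))) (+-identityˡ _)
  reduces : ∀ j → (u ⊗ ((Iₘ 1 ⊕ Q′.mat) ⊗ (mat₂ s (- q) t p ⊕ Iₘ n))) zero (suc j) ≡ 0ℤ
  reduces j = trans (sym (⊗-assoc u (Iₘ 1 ⊕ Q′.mat) (mat₂ s (- q) t p ⊕ Iₘ n) zero (suc j))) (reduces′ j)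
    where
    reduces′ : ∀ j → (w ⊗ (mat₂ s (- q) t p ⊕ Iₘ n)) zero (suc j) ≡ 0ℤ
    reduces′ zero = begin
      w zero zero * - q + (w zero (suc zero) * p + sumℤ n (λ l → w zero (suc (suc l)) * 0ℤ))
        ≡⟨ cong (λ z → w zero zero * - q + (w zero (suc zero) * p + z))
                (sumℤ-zero n (λ l → *-zeroʳ (w zero (suc (suc l))))) ⟩
      w zero zero * - q + (w zero (suc zero) * p + 0ℤ)
        ≡⟨ cong₂ (λ x y → x * - q + (y * p + 0ℤ)) w₀≡ (trans (w-suc≡ zero) b≡d*q) ⟩
      d * p * - q + (d * q * p + 0ℤ)
        ≡⟨ cancel d p q ⟩
      0ℤ ∎
      where
      open ≡-Reasoning
      cancel : ∀ d p q → d * p * - q + (d * q * p + 0ℤ) ≡ 0ℤ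
      cancel = solve-∀
    reduces′ (suc j) = begin
      w zero zero * 0ℤ + (w zero (suc zero) * 0ℤ + sumℤ n (λ l → w zero (suc (suc l)) * Iₘ n l j))
        ≡⟨ cong₂ _+_ (*-zeroʳ (w zero zero)) (cong₂ _+_ (*-zeroʳ (w zero (suc zero))) refl) ⟩
      0ℤ + (0ℤ + sumℤ n (λ l → w zero (suc (suc l)) * Iₘ n l j))
        ≡⟨ trans (+-identityˡ _) (+-identityˡ _) ⟩
      sumℤ n (λ l → w zero (suc (suc l)) * Iₘ n l j)
        ≡⟨ ⊗-identityʳ {1} (λ _ l → w zero (suc (suc l))) zero j ⟩
      w zero (suc (suc j))
        ≡⟨ trans (w-suc≡ (suc j)) (Q′-reduces j) ⟩
      0ℤ ∎
      where open ≡-Reasoning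

strictlyIncreasing-∘suc : ∀ {n m} {σ : Fin (suc n) → Fin m} →
  StrictlyIncreasing σ → StrictlyIncreasing (σ ∘ suc)
strictlyIncreasing-∘suc σ↑ i j i<j = σ↑ (suc i) (suc j) (s≤s i<j)

strictlyIncreasing-lowerBound : ∀ {n m} (σ : Fin (suc n) → Fin m) → StrictlyIncreasing σ →
  ∀ i → toℕ i ℕ.+ toℕ (σ zero) ℕ.≤ toℕ (σ i)
strictlyIncreasing-lowerBound         σ σ↑ zero    = ℕₚ.≤-refl
strictlyIncreasing-lowerBound {suc n} σ σ↑ (suc i) = begin
  suc (toℕ i ℕ.+ toℕ (σ zero))    ≡⟨ ℕₚ.+-suc (toℕ i) (toℕ (σ zero)) ⟨
  toℕ i ℕ.+ suc (toℕ (σ zero))    ≤⟨ ℕₚ.+-monoʳ-≤ (toℕ i) (σ↑ zero (suc zero) (s≤s z≤n)) ⟩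
  toℕ i ℕ.+ toℕ (σ (suc zero))    ≤⟨ strictlyIncreasing-lowerBound (σ ∘ suc) (strictlyIncreasing-∘suc σ↑) i ⟩
  toℕ (σ (suc i))                 ∎
  where open ℕₚ.≤-Reasoning

strictlyIncreasing-upperBound : ∀ {n m} (σ : Fin n → Fin m) → StrictlyIncreasing σ →
  ∀ i → toℕ (σ i) ℕ.+ n ℕ.≤ m ℕ.+ toℕ i
strictlyIncreasing-upperBound {suc zero} {m} σ σ↑ zero = begin
  toℕ (σ zero) ℕ.+ 1    ≡⟨ ℕₚ.+-comm (toℕ (σ zero)) 1 ⟩
  suc (toℕ (σ zero))    ≤⟨ Finₚ.toℕ<n (σ zero) ⟩
  m                     ≡⟨ ℕₚ.+-identityʳ m ⟨
  m ℕ.+ 0               ∎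
  where open ℕₚ.≤-Reasoning
strictlyIncreasing-upperBound {suc (suc n)} {m} σ σ↑ zero = begin
  toℕ (σ zero) ℕ.+ suc (suc n)    ≡⟨ ℕₚ.+-suc (toℕ (σ zero)) (suc n) ⟩
  suc (toℕ (σ zero)) ℕ.+ suc n    ≤⟨ ℕₚ.+-monoˡ-≤ (suc n) (σ↑ zero (suc zero) (s≤s z≤n)) ⟩
  toℕ (σ (suc zero)) ℕ.+ suc n    ≤⟨ strictlyIncreasing-upperBound (σ ∘ suc) (strictlyIncreasing-∘suc σ↑) zero ⟩
  m ℕ.+ 0                         ∎
  where open ℕₚ.≤-Reasoning
strictlyIncreasing-upperBound {suc n} {m} σ σ↑ (suc i) = begin
  toℕ (σ (suc i)) ℕ.+ suc n      ≡⟨ ℕₚ.+-suc (toℕ (σ (suc i))) n ⟩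
  suc (toℕ (σ (suc i)) ℕ.+ n)    ≤⟨ s≤s (strictlyIncreasing-upperBound (σ ∘ suc) (strictlyIncreasing-∘suc σ↑) i) ⟩
  suc (m ℕ.+ toℕ i)              ≡⟨ ℕₚ.+-suc m (toℕ i) ⟨
  m ℕ.+ suc (toℕ i)              ∎
  where open ℕₚ.≤-Reasoning

strictlyIncreasing⇒≤ : ∀ {n m} (σ : Fin n → Fin m) → StrictlyIncreasing σ → n ℕ.≤ m
strictlyIncreasing⇒≤ {zero}      σ σ↑ = z≤n
strictlyIncreasing⇒≤ {suc n} {m} σ σ↑ = begin
  suc n                          ≤⟨ ℕₚ.m≤n+m (suc n) (toℕ (σ zero)) ⟩
  toℕ (σ zero) ℕ.+ suc n         ≤⟨ strictlyIncreasing-upperBound σ σ↑ zero ⟩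
  m ℕ.+ 0                        ≡⟨ ℕₚ.+-identityʳ m ⟩
  m                              ∎
  where open ℕₚ.≤-Reasoning

strictlyIncreasing⇒≗id : ∀ {n} (ρ : Fin n → Fin n) → StrictlyIncreasing ρ → ∀ i → ρ i ≡ i
strictlyIncreasing⇒≗id {suc n} ρ ρ↑ i = Finₚ.toℕ-injective (ℕₚ.≤-antisym ρi≤i i≤ρi)
  where
  ρi≤i : toℕ (ρ i) ℕ.≤ toℕ i
  ρi≤i = ℕₚ.+-cancelʳ-≤ (suc n) (toℕ (ρ i)) (toℕ i)
           (subst (toℕ (ρ i) ℕ.+ suc n ℕ.≤_) (ℕₚ.+-comm (suc n) (toℕ i))
                  (strictlyIncreasing-upperBound ρ ρ↑ i))
  i≤ρi : toℕ i ℕ.≤ toℕ (ρ i)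
  i≤ρi = ℕₚ.≤-trans (ℕₚ.m≤m+n (toℕ i) _) (strictlyIncreasing-lowerBound ρ ρ↑ i)

strictlyIncreasing-∘punchIn : ∀ {n m} {κ : Fin (suc n) → Fin m} (j : Fin (suc n)) →
  StrictlyIncreasing κ → StrictlyIncreasing (κ ∘ punchIn j)
strictlyIncreasing-∘punchIn j κ↑ i k i<k = κ↑ (punchIn j i) (punchIn j k) (punchIn-mono-< j i k i<k)
  where
  punchIn-mono-< : ∀ {n} (j : Fin (suc n)) (i k : Fin n) → i Fin.< k → punchIn j i Fin.< punchIn j k
  punchIn-mono-< zero    i       k       i<k       = s≤s i<k
  punchIn-mono-< (suc j) zero    (suc k) _         = s≤s z≤n
  punchIn-mono-< (suc j) (suc i) (suc k) (s≤s i<k) = s≤s (punchIn-mono-< j i k i<k)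

MaximalMinorsCoprime : ∀ {r m} → Mat r m → Set
MaximalMinorsCoprime {r} M =
  ∀ e → (∀ κ → StrictlyIncreasing κ → e ℤ∣.∣ minor r M id κ) → e ℤ∣.∣ 1ℤ

isDk⇒maximalMinorsCoprime : ∀ {r m} (M : Mat r m) → IsDk r M 1 → MaximalMinorsCoprime M
isDk⇒maximalMinorsCoprime {r} M (_ , 1-greatest) e e∣minors =
  ℤ∣.∣ᵤ⇒∣ (1-greatest ∣ e ∣ λ ρ κ ρ↑ κ↑ _ →
    subst (λ x → ∣ e ∣ ℕ∣.∣ ∣ x ∣)
          (det-cong r (λ i j → cong (λ x → M x (κ j)) (sym (strictlyIncreasing⇒≗id ρ ρ↑ i))))
          (ℤ∣.∣⇒∣ᵤ (e∣minors κ κ↑)))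

-- With r > m there are no maximal minors, so 0 would have to divide 1.
maximalMinorsCoprime⇒≤ : ∀ {r m} (M : Mat r m) → MaximalMinorsCoprime M → r ℕ.≤ m
maximalMinorsCoprime⇒≤ {r} {m} M coprime with r ℕ.≤? m
... | yes r≤m = r≤m
... | no  r≰m with ℤ∣.0∣⇒≡0 (coprime 0ℤ (λ κ κ↑ → ⊥-elim (r≰m (strictlyIncreasing⇒≤ κ κ↑))))
...   | ()

∣-sumℤ : ∀ n {e} {f : Fin n → ℤ} → (∀ i → e ℤ∣.∣ f i) → e ℤ∣.∣ sumℤ n f
∣-sumℤ zero    e∣f = ℤ∣.divides 0ℤ refl
∣-sumℤ (suc n) e∣f = ℤ∣.∣m∣n⇒∣m+n (e∣f zero) (∣-sumℤ n (e∣f ∘ suc))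

-- A maximal minor of M expands along the first row into maximal minors of tail M.
maximalMinorsCoprime-tail : ∀ {r m} (M : Mat (suc r) m) →
  MaximalMinorsCoprime M → MaximalMinorsCoprime (tail M)
maximalMinorsCoprime-tail {r} M coprime e e∣minors = coprime e λ κ κ↑ →
  ∣-sumℤ (suc r) λ j → ℤ∣.∣n⇒∣m*n (alt (toℕ j)) (ℤ∣.∣n⇒∣m*n (M zero (κ j))
    (e∣minors (κ ∘ punchIn j) (strictlyIncreasing-∘punchIn j κ↑)))

∣i∣≡1⇒i*i≡1 : ∀ i → ∣ i ∣ ≡ 1 → i * i ≡ 1ℤ
∣i∣≡1⇒i*i≡1 (+ _)       refl = refl
∣i∣≡1⇒i*i≡1 -[1+ zero ] refl = refl

-- By det-row₀-combination, g divides every maximal minor.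
row₀-coefficient-unit : ∀ {r m} (M : Mat (suc r) m) → MaximalMinorsCoprime M →
  ∀ g (w : Fin m → ℤ) (c : Fin r → ℤ) →
  (∀ x → M zero x ≡ g * w x + sumℤ r (λ t → c t * M (suc t) x)) →
  g * g ≡ 1ℤ
row₀-coefficient-unit {r} M coprime g w c M₀≡ =
  ∣i∣≡1⇒i*i≡1 g (ℕ∣.∣1⇒≡1 (ℤ∣.∣⇒∣ᵤ (coprime g λ κ κ↑ →
    ℤ∣.divides (det (suc r) ((w ∘ κ) ∷ tail (λ i j → M i (κ j))))
      (trans (det-row₀-combination r (λ i j → M i (κ j)) g (w ∘ κ) c (M₀≡ ∘ κ))
             (*-comm g _)))))

-- The columns of N form a basis of ker M, and L, R witness that it is a direct summand.
record Splitting {r m} (M : Mat r m) (n : ℕ) : Set where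
  field
    N : Mat m n
    L : Mat n m
    R : Mat m r
    M⊗N≋0     : M ⊗ N ≋ 0ᴹ
    L⊗N≋I     : L ⊗ N ≋ Iₘ n
    N⊗L+R⊗M≋I : (N ⊗ L) +ᴹ (R ⊗ M) ≋ Iₘ m

splitting-empty : ∀ {m} (M : Mat 0 m) → Splitting M m
splitting-empty {m} M = record
  { N = Iₘ m ; L = Iₘ m ; R = λ _ ()
  ; M⊗N≋0 = λ ()
  ; L⊗N≋I = ⊗-identityˡ (Iₘ m)
  ; N⊗L+R⊗M≋I = λ i j → trans (+-identityʳ _) (⊗-identityˡ (Iₘ m) i j) }

splitting-changeBasis : ∀ {r m n} {M : Mat r m} → Splitting M n → Invertible n → Splitting M n
splitting-changeBasis {M = M} S Q = record
  { N = N ⊗ Q.mat ; L = Q.inv ⊗ L ; R = R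
  ; M⊗N≋0 = begin
      M ⊗ (N ⊗ Q.mat)    ≈⟨ ⊗-assoc M N Q.mat ⟨
      (M ⊗ N) ⊗ Q.mat    ≈⟨ ⊗-congˡ Q.mat M⊗N≋0 ⟩
      0ᴹ ⊗ Q.mat         ≈⟨ ⊗-zeroˡ Q.mat ⟩
      0ᴹ                 ∎
  ; L⊗N≋I = ≋-trans (⊗-cancel-middle Q.inv L N Q.mat L⊗N≋I) Q.inverseˡ
  ; N⊗L+R⊗M≋I = λ i j → trans (cong (_+ (R ⊗ M) i j) (⊗-cancel-middle N Q.mat Q.inv L Q.inverseʳ i j))
                               (N⊗L+R⊗M≋I i j) }
  where
  open Splitting S
  module Q = Invertible Q
  open ≋-Reasoning

row : ∀ {m} → (Fin m → ℤ) → Mat 1 m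
row v _ = v

module _ {r m n} (M : Mat (suc r) m) (S : Splitting (tail M) (suc n))
         (v⊗N-reduced : ∀ j → (row (M zero) ⊗ Splitting.N S) zero (suc j) ≡ 0ℤ) where

  open Splitting S renaming (M⊗N≋0 to M₊⊗N≋0; N⊗L+R⊗M≋I to N⊗L+R⊗M₊≋I)

  private
    v : Fin m → ℤ
    v = M zero
    M₊ : Mat r m
    M₊ = tail M

  pivot : ℤ
  pivot = (row v ⊗ N) zero zero

  pivotCoefficients : Fin r → ℤ
  pivotCoefficients = (row v ⊗ R) zero

  private
    g : ℤ
    g = pivot
    c : Fin r → ℤ
    c = pivotCoefficients

  -- v = v (N L + R M), and v N = (g, 0, …, 0).
  splitting-row-decomposition : ∀ x → v x ≡ g * L zero x + sumℤ r (λ t → c t * M₊ t x)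
  splitting-row-decomposition x = begin
    v x
      ≡⟨ ⊗-identityʳ (row v) zero x ⟨
    (row v ⊗ Iₘ m) zero x
      ≡⟨ ⊗-congʳ (row v) N⊗L+R⊗M₊≋I zero x ⟨
    (row v ⊗ ((N ⊗ L) +ᴹ (R ⊗ M₊))) zero x
      ≡⟨ ⊗-distribˡ-+ᴹ (row v) (N ⊗ L) (R ⊗ M₊) zero x ⟩
    (row v ⊗ (N ⊗ L)) zero x + (row v ⊗ (R ⊗ M₊)) zero x
      ≡⟨ cong₂ _+_ (⊗-assoc (row v) N L zero x) (⊗-assoc (row v) R M₊ zero x) ⟨
    ((row v ⊗ N) ⊗ L) zero x + ((row v ⊗ R) ⊗ M₊) zero x
      ≡⟨ cong (_+ ((row v ⊗ R) ⊗ M₊) zero x) first-column ⟩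
    g * L zero x + sumℤ r (λ t → c t * M₊ t x) ∎
    where
    open ≡-Reasoning
    first-column : ((row v ⊗ N) ⊗ L) zero x ≡ g * L zero x
    first-column = trans (cong (_+_ (g * L zero x))
                               (sumℤ-zero n (λ j → cong (_* L (suc j) x) (v⊗N-reduced j))))
                         (+-identityʳ _)

  splitting-∷ : g * g ≡ 1ℤ → Splitting M n
  splitting-∷ g²≡1 = record
    { N = N′ ; L = L′ ; R = R′
    ; M⊗N≋0 = λ { zero j → v⊗N-reduced j ; (suc t) j → M₊⊗N≋0 t (suc j) }
    ; L⊗N≋I = λ j k → trans (L⊗N≋I (suc j) (suc k)) (Iₘ-suc n j k)
    ; N⊗L+R⊗M≋I = λ x y → begin
        (N′ ⊗ L′) x y + (R′ ⊗ M) x y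
          ≡⟨ cong (_+_ ((N′ ⊗ L′) x y)) (R′-contribution x y) ⟩
        (N′ ⊗ L′) x y + (N x zero * L zero y + (R ⊗ M₊) x y)
          ≡⟨ swap-assoc ((N′ ⊗ L′) x y) (N x zero * L zero y) ((R ⊗ M₊) x y) ⟩
        (N ⊗ L) x y + (R ⊗ M₊) x y
          ≡⟨ N⊗L+R⊗M₊≋I x y ⟩
        Iₘ m x y ∎ }
    where
    open ≡-Reasoning
    swap-assoc : ∀ a b c → a + (b + c) ≡ (b + a) + c
    swap-assoc = solve-∀
    N′ : Mat m n
    N′ x j = N x (suc j)
    L′ : Mat n m
    L′ j x = L (suc j) x
    R′ : Mat m (suc r)
    R′ x = g * N x zero ∷ λ t → R x t + - (g * N x zero) * c t
    R′-contribution : ∀ x y → (R′ ⊗ M) x y ≡ N x zero * L zero y + (R ⊗ M₊) x y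
    R′-contribution x y = begin
      g * N x zero * v y + sumℤ r (λ t → (R x t + - (g * N x zero) * c t) * M₊ t y)
        ≡⟨ cong₂ _+_ (cong (g * N x zero *_) (splitting-row-decomposition y)) tail-sum ⟩
      g * N x zero * (g * L zero y + Σc) + ((R ⊗ M₊) x y + - (g * N x zero) * Σc)
        ≡⟨ regroup g (N x zero) (L zero y) Σc ((R ⊗ M₊) x y) ⟩
      g * g * (N x zero * L zero y) + (R ⊗ M₊) x y
        ≡⟨ cong (λ h → h * (N x zero * L zero y) + (R ⊗ M₊) x y) g²≡1 ⟩
      1ℤ * (N x zero * L zero y) + (R ⊗ M₊) x y
        ≡⟨ cong (_+ (R ⊗ M₊) x y) (*-identityˡ (N x zero * L zero y)) ⟩
      N x zero * L zero y + (R ⊗ M₊) x y ∎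
      where
      Σc k : ℤ
      Σc = sumℤ r (λ t → c t * M₊ t y)
      k = - (g * N x zero)
      tail-sum : sumℤ r (λ t → (R x t + k * c t) * M₊ t y) ≡ (R ⊗ M₊) x y + k * Σc
      tail-sum = begin
        sumℤ r (λ t → (R x t + k * c t) * M₊ t y)
          ≡⟨ sumℤ-cong r (λ t → trans (*-distribʳ-+ (M₊ t y) (R x t) (k * c t))
                                      (cong (_+_ (R x t * M₊ t y)) (*-assoc k (c t) (M₊ t y)))) ⟩
        sumℤ r (λ t → R x t * M₊ t y + k * (c t * M₊ t y))
          ≡⟨ sumℤ-distrib-+ r (λ t → R x t * M₊ t y) (λ t → k * (c t * M₊ t y)) ⟩
        (R ⊗ M₊) x y + sumℤ r (λ t → k * (c t * M₊ t y))
          ≡⟨ cong (_+_ ((R ⊗ M₊) x y)) (*-distribˡ-sumℤ r k (λ t → c t * M₊ t y)) ⟨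
        (R ⊗ M₊) x y + k * Σc ∎
      regroup : ∀ g n l s b → g * n * (g * l + s) + (b + - (g * n) * s) ≡ g * g * (n * l) + b
      regroup = solve-∀

splitting : ∀ r {m} (M : Mat r m) → MaximalMinorsCoprime M → ∀ n → n ℕ.+ r ≡ m → Splitting M n
splitting zero M _ n n+0≡m =
  subst (Splitting M) (trans (sym n+0≡m) (ℕₚ.+-identityʳ n)) (splitting-empty M)
splitting (suc r) M coprime n n+r≡m = splitting-∷ M S reduced pivot²≡1
  where
  S₊ : Splitting (tail M) (suc n)
  S₊ = splitting r (tail M) (maximalMinorsCoprime-tail M coprime) (suc n) (trans (sym (ℕₚ.+-suc n r)) n+r≡m)
  Q-reduction : Σ (Invertible (suc n)) λ Q →
    ∀ j → ((row (M zero) ⊗ Splitting.N S₊) ⊗ Invertible.mat Q) zero (suc j) ≡ 0ℤ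
  Q-reduction = row-reduction n (row (M zero) ⊗ Splitting.N S₊)
  S : Splitting (tail M) (suc n)
  S = splitting-changeBasis S₊ (proj₁ Q-reduction)
  reduced : ∀ j → (row (M zero) ⊗ Splitting.N S) zero (suc j) ≡ 0ℤ
  reduced j =
    trans (sym (⊗-assoc (row (M zero)) (Splitting.N S₊) (Invertible.mat (proj₁ Q-reduction)) zero (suc j)))
          (proj₂ Q-reduction j)
  pivot²≡1 : pivot M S reduced * pivot M S reduced ≡ 1ℤ
  pivot²≡1 = row₀-coefficient-unit M coprime
               (pivot M S reduced) (Splitting.L S zero) (pivotCoefficients M S reduced)
               (splitting-row-decomposition M S reduced)

∣∣-↑ˡ : ∀ {a b c} (P : Mat a b) (Q : Mat a c) i j → (P ∣∣ Q) i (j ↑ˡ c) ≡ P i j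
∣∣-↑ˡ {b = b} {c} P Q i j rewrite Finₚ.splitAt-↑ˡ b j c = refl

∣∣-↑ʳ : ∀ {a b c} (P : Mat a b) (Q : Mat a c) i j → (P ∣∣ Q) i (b ↑ʳ j) ≡ Q i j
∣∣-↑ʳ {b = b} {c} P Q i j rewrite Finₚ.splitAt-↑ʳ b c j = refl

module Action (G : AbelianGroup 0ℓ 0ℓ) where

  open AbelianGroup G renaming (Carrier to A; refl to ≈-refl; sym to ≈-sym; trans to ≈-trans)
  open import Algebra.Properties.AbelianGroup G using (⁻¹-∙-comm; ε⁻¹≈ε; ⁻¹-involutive)
  open import Algebra.Properties.CommutativeMonoid.Mult commutativeMonoid
    using (×-congʳ; ×-distrib-+) renaming (_×_ to _·_)
  open import Algebra.Properties.CommutativeSemigroup commutativeSemigroup using (interchange)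
  open SetoidReasoning setoid

  zmul-≡ : ∀ {a b} x → a ≡ b → zmul G a x ≈ zmul G b x
  zmul-≡ x refl = ≈-refl

  zmul-cong : ∀ a {x y} → x ≈ y → zmul G a x ≈ zmul G a y
  zmul-cong (+ n)    x≈y = ×-congʳ n x≈y
  zmul-cong -[1+ n ] x≈y = ⁻¹-cong (×-congʳ (suc n) x≈y)

  zmul-1+ : ∀ a x → zmul G (1ℤ + a) x ≈ x ∙ zmul G a x
  zmul-1+ (+ n)          x = ≈-refl
  zmul-1+ -[1+ zero ]    x = begin
    ε                      ≈⟨ inverseʳ x ⟨
    x ∙ x ⁻¹               ≈⟨ ∙-congˡ (⁻¹-cong (identityʳ x)) ⟨
    x ∙ (x ∙ ε) ⁻¹         ∎
  zmul-1+ -[1+ suc n ]   x = begin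
    (suc n · x) ⁻¹                     ≈⟨ identityˡ _ ⟨
    ε ∙ (suc n · x) ⁻¹                 ≈⟨ ∙-congʳ (inverseʳ x) ⟨
    (x ∙ x ⁻¹) ∙ (suc n · x) ⁻¹        ≈⟨ assoc x (x ⁻¹) _ ⟩
    x ∙ (x ⁻¹ ∙ (suc n · x) ⁻¹)        ≈⟨ ∙-congˡ (⁻¹-∙-comm x (suc n · x)) ⟩
    x ∙ (x ∙ suc n · x) ⁻¹             ∎

  zmul--1+ : ∀ a x → zmul G (-1ℤ + a) x ≈ x ⁻¹ ∙ zmul G a x
  zmul--1+ (+ zero)    x = begin
    (x ∙ ε) ⁻¹             ≈⟨ ⁻¹-cong (identityʳ x) ⟩
    x ⁻¹                   ≈⟨ identityʳ (x ⁻¹) ⟨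
    x ⁻¹ ∙ ε               ∎
  zmul--1+ (+ suc n)   x = begin
    n · x                  ≈⟨ identityˡ _ ⟨
    ε ∙ n · x              ≈⟨ ∙-congʳ (inverseˡ x) ⟨
    (x ⁻¹ ∙ x) ∙ n · x     ≈⟨ assoc (x ⁻¹) x _ ⟩
    x ⁻¹ ∙ (x ∙ n · x)     ∎
  zmul--1+ -[1+ n ]    x = ≈-sym (⁻¹-∙-comm x (suc n · x))

  zmul-+ : ∀ a b x → zmul G (a + b) x ≈ zmul G a x ∙ zmul G b x
  zmul-+ (+ zero)       b x = ≈-trans (zmul-≡ x (+-identityˡ b)) (≈-sym (identityˡ _))
  zmul-+ (+ suc n)      b x = begin
    zmul G (+ suc n + b) x             ≡⟨ cong (λ c → zmul G c x) (+-assoc 1ℤ (+ n) b) ⟩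
    zmul G (1ℤ + (+ n + b)) x          ≈⟨ zmul-1+ (+ n + b) x ⟩
    x ∙ zmul G (+ n + b) x             ≈⟨ ∙-congˡ (zmul-+ (+ n) b x) ⟩
    x ∙ (n · x ∙ zmul G b x)           ≈⟨ assoc x (n · x) _ ⟨
    suc n · x ∙ zmul G b x             ∎
  zmul-+ -[1+ zero ]    b x = begin
    zmul G (-1ℤ + b) x                 ≈⟨ zmul--1+ b x ⟩
    x ⁻¹ ∙ zmul G b x                  ≈⟨ ∙-congʳ (⁻¹-cong (identityʳ x)) ⟨
    (x ∙ ε) ⁻¹ ∙ zmul G b x            ∎
  zmul-+ -[1+ suc n ]   b x = begin
    zmul G (-[1+ suc n ] + b) x        ≡⟨ cong (λ c → zmul G c x) (+-assoc -1ℤ -[1+ n ] b) ⟩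
    zmul G (-1ℤ + (-[1+ n ] + b)) x    ≈⟨ zmul--1+ (-[1+ n ] + b) x ⟩
    x ⁻¹ ∙ zmul G (-[1+ n ] + b) x     ≈⟨ ∙-congˡ (zmul-+ -[1+ n ] b x) ⟩
    x ⁻¹ ∙ ((suc n · x) ⁻¹ ∙ zmul G b x) ≈⟨ assoc (x ⁻¹) _ _ ⟨
    (x ⁻¹ ∙ (suc n · x) ⁻¹) ∙ zmul G b x ≈⟨ ∙-congʳ (zmul--1+ -[1+ n ] x) ⟨
    zmul G -[1+ suc n ] x ∙ zmul G b x ∎

  zmul-neg : ∀ a x → zmul G (- a) x ≈ (zmul G a x) ⁻¹
  zmul-neg (+ zero)  x = ≈-sym ε⁻¹≈ε
  zmul-neg (+ suc n) x = ≈-refl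
  zmul-neg -[1+ n ]  x = ≈-sym (⁻¹-involutive _)

  zmul-*ℕ : ∀ n b x → zmul G (+ n * b) x ≈ n · zmul G b x
  zmul-*ℕ zero    b x = zmul-≡ x (*-zeroˡ b)
  zmul-*ℕ (suc n) b x = begin
    zmul G (+ suc n * b) x             ≡⟨ cong (λ c → zmul G c x) (suc-* (+ n) b) ⟩
    zmul G (b + + n * b) x             ≈⟨ zmul-+ b (+ n * b) x ⟩
    zmul G b x ∙ zmul G (+ n * b) x    ≈⟨ ∙-congˡ (zmul-*ℕ n b x) ⟩
    zmul G b x ∙ n · zmul G b x        ∎

  zmul-* : ∀ a b x → zmul G (a * b) x ≈ zmul G a (zmul G b x)
  zmul-* (+ n)    b x = zmul-*ℕ n b x
  zmul-* -[1+ n ] b x = begin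
    zmul G (-[1+ n ] * b) x            ≡⟨ cong (λ c → zmul G c x) (neg-distribˡ-* (+ suc n) b) ⟨
    zmul G (- (+ suc n * b)) x         ≈⟨ zmul-neg (+ suc n * b) x ⟩
    (zmul G (+ suc n * b) x) ⁻¹        ≈⟨ ⁻¹-cong (zmul-*ℕ (suc n) b x) ⟩
    (suc n · zmul G b x) ⁻¹            ∎

  zmul-∙ : ∀ a x y → zmul G a (x ∙ y) ≈ zmul G a x ∙ zmul G a y
  zmul-∙ (+ n)    x y = ×-distrib-+ x y n
  zmul-∙ -[1+ n ] x y = ≈-trans (⁻¹-cong (×-distrib-+ x y (suc n))) (≈-sym (⁻¹-∙-comm _ _))

  zmul-ε : ∀ a → zmul G a ε ≈ ε
  zmul-ε (+ n)    = εℕ n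
    where
    εℕ : ∀ n → n · ε ≈ ε
    εℕ zero    = ≈-refl
    εℕ (suc n) = ≈-trans (identityˡ _) (εℕ n)
  zmul-ε -[1+ n ] = ≈-trans (⁻¹-cong (zmul-ε (+ suc n))) ε⁻¹≈ε

  sumG-cong : ∀ n {f h : Fin n → A} → (∀ i → f i ≈ h i) → sumG G n f ≈ sumG G n h
  sumG-cong zero    f≈h = ≈-refl
  sumG-cong (suc n) f≈h = ∙-cong (f≈h zero) (sumG-cong n (f≈h ∘ suc))

  sumG-ε : ∀ n {f : Fin n → A} → (∀ i → f i ≈ ε) → sumG G n f ≈ ε
  sumG-ε zero    f≈ε = ≈-refl
  sumG-ε (suc n) f≈ε = ≈-trans (∙-cong (f≈ε zero) (sumG-ε n (f≈ε ∘ suc))) (identityˡ ε)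

  sumG-∙ : ∀ n (f h : Fin n → A) → sumG G n (λ i → f i ∙ h i) ≈ sumG G n f ∙ sumG G n h
  sumG-∙ zero    f h = ≈-sym (identityˡ ε)
  sumG-∙ (suc n) f h = ≈-trans (∙-congˡ (sumG-∙ n (f ∘ suc) (h ∘ suc))) (interchange _ _ _ _)

  sumG-comm : ∀ n k (F : Fin n → Fin k → A) →
    sumG G n (λ i → sumG G k (F i)) ≈ sumG G k (λ j → sumG G n (λ i → F i j))
  sumG-comm zero    k F = ≈-sym (sumG-ε k (λ _ → ≈-refl))
  sumG-comm (suc n) k F = ≈-trans (∙-congˡ (sumG-comm n k (F ∘ suc))) (≈-sym (sumG-∙ k (F zero) _))

  sumG-↑ : ∀ a b (f : Fin (a ℕ.+ b) → A) →
    sumG G (a ℕ.+ b) f ≈ sumG G a (f ∘ (_↑ˡ b)) ∙ sumG G b (f ∘ (a ↑ʳ_))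
  sumG-↑ zero    b f = ≈-sym (identityˡ _)
  sumG-↑ (suc a) b f = ≈-trans (∙-congˡ (sumG-↑ a b (f ∘ suc))) (≈-sym (assoc _ _ _))

  zmul-sumG : ∀ a n (f : Fin n → A) → zmul G a (sumG G n f) ≈ sumG G n (λ i → zmul G a (f i))
  zmul-sumG a zero    f = zmul-ε a
  zmul-sumG a (suc n) f = ≈-trans (zmul-∙ a _ _) (∙-congˡ (zmul-sumG a n (f ∘ suc)))

  zmul-sumℤ : ∀ n (f : Fin n → ℤ) x → zmul G (sumℤ n f) x ≈ sumG G n (λ i → zmul G (f i) x)
  zmul-sumℤ zero    f x = ≈-refl
  zmul-sumℤ (suc n) f x = ≈-trans (zmul-+ (f zero) _ x) (∙-congˡ (zmul-sumℤ n (f ∘ suc) x))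

  -- InKer G M x unfolds to ∀ i → act M x i ≈ ε.
  act : ∀ {a b} → Mat a b → (Fin b → A) → Fin a → A
  act {b = b} M x i = sumG G b (λ j → zmul G (M i j) (x j))

  act-congˡ : ∀ {a b} {M M′ : Mat a b} → M ≋ M′ → ∀ x i → act M x i ≈ act M′ x i
  act-congˡ {b = b} M≋M′ x i = sumG-cong b (λ j → zmul-≡ (x j) (M≋M′ i j))

  act-congʳ : ∀ {a b} (M : Mat a b) {x y : Fin b → A} → (∀ j → x j ≈ y j) → ∀ i → act M x i ≈ act M y i
  act-congʳ {b = b} M x≈y i = sumG-cong b (λ j → zmul-cong (M i j) (x≈y j))

  act-⊗ : ∀ {a b c} (M : Mat a b) (N : Mat b c) x i → act (M ⊗ N) x i ≈ act M (act N x) i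
  act-⊗ {b = b} {c} M N x i = begin
    sumG G c (λ k → zmul G (sumℤ b (λ j → M i j * N j k)) (x k))
      ≈⟨ sumG-cong c (λ k → ≈-trans (zmul-sumℤ b (λ j → M i j * N j k) (x k))
                                    (sumG-cong b (λ j → zmul-* (M i j) (N j k) (x k)))) ⟩
    sumG G c (λ k → sumG G b (λ j → zmul G (M i j) (zmul G (N j k) (x k))))
      ≈⟨ sumG-comm c b _ ⟩
    sumG G b (λ j → sumG G c (λ k → zmul G (M i j) (zmul G (N j k) (x k))))
      ≈⟨ sumG-cong b (λ j → zmul-sumG (M i j) c (λ k → zmul G (N j k) (x k))) ⟨
    act M (act N x) i ∎

  act-+ᴹ : ∀ {a b} (M N : Mat a b) x i → act (M +ᴹ N) x i ≈ act M x i ∙ act N x i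
  act-+ᴹ {b = b} M N x i = ≈-trans (sumG-cong b (λ j → zmul-+ (M i j) (N i j) (x j))) (sumG-∙ b _ _)

  act-Iₘ : ∀ n x i → act (Iₘ n) x i ≈ x i
  act-Iₘ (suc n) x zero    = ≈-trans (∙-cong (identityʳ (x zero)) (sumG-ε n (λ _ → ≈-refl))) (identityʳ _)
  act-Iₘ (suc n) x (suc i) = ≈-trans (identityˡ _)
    (≈-trans (sumG-cong n (λ j → zmul-≡ (x (suc j)) (Iₘ-suc n i j))) (act-Iₘ n (x ∘ suc) i))

  act-0ᴹ : ∀ {a b} x (i : Fin a) → act (0ᴹ {a} {b}) x i ≈ ε
  act-0ᴹ {b = b} x i = sumG-ε b (λ _ → ≈-refl)

  act--ᴹ : ∀ {a b} (M : Mat a b) x i → act (-ᴹ M) x i ≈ (act M x i) ⁻¹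
  act--ᴹ {b = b} M x i = ≈-trans (sumG-cong b (λ j → zmul-neg (M i j) (x j))) (sumG-⁻¹ b _)
    where
    sumG-⁻¹ : ∀ n (f : Fin n → A) → sumG G n (λ j → f j ⁻¹) ≈ (sumG G n f) ⁻¹
    sumG-⁻¹ zero    f = ≈-sym ε⁻¹≈ε
    sumG-⁻¹ (suc n) f = ≈-trans (∙-congˡ (sumG-⁻¹ n (f ∘ suc))) (⁻¹-∙-comm _ _)

  act-∣∣ : ∀ {a b c} (P : Mat a b) (Q : Mat a c) x i →
    act (P ∣∣ Q) x i ≈ act P (x ∘ (_↑ˡ c)) i ∙ act Q (x ∘ (b ↑ʳ_)) i
  act-∣∣ {b = b} {c} P Q x i = ≈-trans (sumG-↑ b c _)
    (∙-cong (sumG-cong b (λ j → zmul-≡ (x (j ↑ˡ c)) (∣∣-↑ˡ P Q i j)))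
            (sumG-cong c (λ j → zmul-≡ (x (b ↑ʳ j)) (∣∣-↑ʳ P Q i j))))

  module _ {r m k} {M : Mat r m} (S : Splitting M k) where

    open Splitting S

    act-M∘N : ∀ z i → act M (act N z) i ≈ ε
    act-M∘N z i = ≈-trans (≈-sym (act-⊗ M N z i)) (≈-trans (act-congˡ M⊗N≋0 z i) (act-0ᴹ z i))

    act-L∘N : ∀ z i → act L (act N z) i ≈ z i
    act-L∘N z i = ≈-trans (≈-sym (act-⊗ L N z i)) (≈-trans (act-congˡ L⊗N≋I z i) (act-Iₘ k z i))

    act-N∘L : ∀ y → InKer G M y → ∀ i → act N (act L y) i ≈ y i
    act-N∘L y My≈ε i = begin
      act N (act L y) i                          ≈⟨ act-⊗ N L y i ⟨
      act (N ⊗ L) y i                            ≈⟨ identityʳ _ ⟨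
      act (N ⊗ L) y i ∙ ε                        ≈⟨ ∙-congˡ (sumG-ε r (λ j → zmul-ε (R i j))) ⟨
      act (N ⊗ L) y i ∙ act R (λ _ → ε) i        ≈⟨ ∙-congˡ (act-congʳ R My≈ε i) ⟨
      act (N ⊗ L) y i ∙ act R (act M y) i        ≈⟨ ∙-congˡ (act-⊗ R M y i) ⟨
      act (N ⊗ L) y i ∙ act (R ⊗ M) y i          ≈⟨ act-+ᴹ (N ⊗ L) (R ⊗ M) y i ⟨
      act ((N ⊗ L) +ᴹ (R ⊗ M)) y i               ≈⟨ act-congˡ N⊗L+R⊗M≋I y i ⟩
      act (Iₘ m) y i                             ≈⟨ act-Iₘ m y i ⟩
      y i                                        ∎

isExtension-≋ : ∀ {r m r′ m′} {M : Mat r m} {M′ M″ : Mat r′ m′} {σ : Fin m → Fin m′} →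
  M′ ≋ M″ → IsExtension M M′ σ → IsExtension M M″ σ
isExtension-≋ {M′ = M′} {M″} M′≋M″ ext G with ext G
... | into , injective , onto =
  (λ x → into x ∘ from″) ,
  (λ x y x∈ y∈ → injective x y (from″ x∈) (from″ y∈)) ,
  (λ y y∈ → let x , x∈ , x≈y = onto y y∈ in x , to″ x∈ , x≈y)
  where
  open AbelianGroup G using (_≈_) renaming (trans to ≈-trans; sym to ≈-sym)
  open Action G using (act-congˡ)
  from″ : ∀ {x} → InKer G M″ x → InKer G M′ x
  from″ {x} x∈ i = ≈-trans (act-congˡ M′≋M″ x i) (x∈ i)
  to″ : ∀ {x} → InKer G M′ x → InKer G M″ x
  to″ {x} x∈ i = ≈-trans (≈-sym (act-congˡ M′≋M″ x i)) (x∈ i)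

-- ker (I | -N) is the graph of N : Gᵏ → Gᵐ, which the splitting identifies with ker M.
splitting⇒isExtension : ∀ {r m k} {M : Mat r m} (S : Splitting M k) →
  IsExtension M (Iₘ m ∣∣ -ᴹ Splitting.N S) (_↑ˡ k)
splitting⇒isExtension {m = m} {k} {M} S G = into , injective , onto
  where
  open Splitting S
  open AbelianGroup G renaming (Carrier to A; sym to ≈-sym; trans to ≈-trans)
  open Action G
  open import Algebra.Properties.AbelianGroup G using (x∙y⁻¹≈ε⇒x≈y)
  M′ : Mat m (m ℕ.+ k)
  M′ = Iₘ m ∣∣ -ᴹ N
  act-M′ : ∀ x i → act M′ x i ≈ x (i ↑ˡ k) ∙ (act N (x ∘ (m ↑ʳ_)) i) ⁻¹
  act-M′ x i = ≈-trans (act-∣∣ (Iₘ m) (-ᴹ N) x i) (∙-cong (act-Iₘ m _ i) (act--ᴹ N _ i))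
  ker-M′ : ∀ x → InKer G M′ x → ∀ i → x (i ↑ˡ k) ≈ act N (x ∘ (m ↑ʳ_)) i
  ker-M′ x x∈ i = x∙y⁻¹≈ε⇒x≈y _ _ (≈-trans (≈-sym (act-M′ x i)) (x∈ i))
  graph⇒ker-M′ : ∀ x → (∀ i → x (i ↑ˡ k) ≈ act N (x ∘ (m ↑ʳ_)) i) → InKer G M′ x
  graph⇒ker-M′ x x≈Nx i = ≈-trans (act-M′ x i) (≈-trans (∙-congʳ (x≈Nx i)) (inverseʳ _))
  into : (x : Fin (m ℕ.+ k) → A) → InKer G M′ x → InKer G M (x ∘ (_↑ˡ k))
  into x x∈ i = ≈-trans (act-congʳ M (ker-M′ x x∈) i) (act-M∘N S (x ∘ (m ↑ʳ_)) i)
  tail-determined : ∀ x → InKer G M′ x → ∀ t → x (m ↑ʳ t) ≈ act L (x ∘ (_↑ˡ k)) t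
  tail-determined x x∈ t =
    ≈-trans (≈-sym (act-L∘N S (x ∘ (m ↑ʳ_)) t)) (act-congʳ L (≈-sym ∘ ker-M′ x x∈) t)
  injective : (x y : Fin (m ℕ.+ k) → A) → InKer G M′ x → InKer G M′ y →
              (∀ j → x (j ↑ˡ k) ≈ y (j ↑ˡ k)) → ∀ j → x j ≈ y j
  injective x y x∈ y∈ x≈y = ↑-ind m k _ x≈y λ t →
    ≈-trans (tail-determined x x∈ t) (≈-trans (act-congʳ L x≈y t) (≈-sym (tail-determined y y∈ t)))
  onto : (y : Fin m → A) → InKer G M y →
         Σ (Fin (m ℕ.+ k) → A) λ x → InKer G M′ x × (∀ j → x (j ↑ˡ k) ≈ y j)
  onto y y∈ = x , graph⇒ker-M′ x x≈Nx , x↑ˡ≈y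
    where
    x : Fin (m ℕ.+ k) → A
    x = y ++ act L y
    x↑ˡ≈y : ∀ j → x (j ↑ˡ k) ≈ y j
    x↑ˡ≈y j = reflexive (lookup-++ˡ y (act L y) j)
    x≈Nx : ∀ i → x (i ↑ˡ k) ≈ act N (x ∘ (m ↑ʳ_)) i
    x≈Nx i = ≈-trans (x↑ˡ≈y i) (≈-trans (≈-sym (act-N∘L S y y∈ i))
                   (act-congʳ N (λ t → reflexive (sym (lookup-++ʳ y (act L y) t))) i))

zeroRow⇒plain : ∀ {r m k} {M : Mat r m} (S : Splitting M k) i →
  (∀ j → Splitting.N S i j ≡ 0ℤ) → Plain M
zeroRow⇒plain {k = k} S i Nᵢ≡0 = i , λ G x x∈ →
  let open AbelianGroup G using () renaming (sym to ≈-sym; trans to ≈-trans)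
      open Action G
  in ≈-trans (≈-sym (act-N∘L S x x∈ i)) (sumG-ε k (λ j → zmul-≡ _ (Nᵢ≡0 j)))

lemma4p7 : (r m : ℕ) (M : Mat r m) →
    HasRank M r → IsDk r M 1 → ¬ Plain M →
    Σ (Mat m m) λ U → Σ (Mat m (m ∸ r)) λ B →
    Unimodular U ×
    (∀ i → ¬ (∀ j → B i j ≡ 0ℤ)) ×
    IsExtension M (U ⊗ (Iₘ m ∣∣ B)) (λ j → j ↑ˡ (m ∸ r))
lemma4p7 r m M _ d-r≡1 notPlain =
  Iₘ m , -ᴹ N , inj₁ (det-Iₘ m) , rows-nonzero ,
  isExtension-≋ {M = M} (≋-sym (⊗-identityˡ (Iₘ m ∣∣ -ᴹ N))) (splitting⇒isExtension S)
  where
  coprime : MaximalMinorsCoprime M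
  coprime = isDk⇒maximalMinorsCoprime M d-r≡1
  S : Splitting M (m ∸ r)
  S = splitting r M coprime (m ∸ r) (ℕₚ.m∸n+n≡m (maximalMinorsCoprime⇒≤ M coprime))
  open Splitting S
  rows-nonzero : ∀ i → ¬ (∀ j → (-ᴹ N) i j ≡ 0ℤ)
  rows-nonzero i -Nᵢ≡0 =
    notPlain (zeroRow⇒plain S i λ j → trans (sym (neg-involutive (N i j))) (cong -_ (-Nᵢ≡0 j)))
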